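{- Let $m\geq0$ and $n\geq1$ be integers and let $r,s$ be integers with $1\leq r,s\leq n$. Then \[ \sum_{c\in\mathcal{C}_{n,m}}t^{\overline U_r(c)}=\sum_{c\in\mathcal{C}^{\mathrm{col}}_{n,m+1}}t^{\overline U_s(c)}=\sum_{c\in\mathcal{C}_{n,m}}t^{V^C(c)}. \] In particular $\#\mathcal{C}_{n,m}=\#\mathcal{C}^{\mathrm{col}}_{n,m+1}$.
   Context: For integers $m'\ge0$, $n\ge1$: $\mathcal{C}_{n,m'}$ is the set of plane partitions $c$ (nonnegative integer arrays with finitely many nonzero entries, weakly decreasing along rows and columns) with at most $n$ nonzero columns, nonzero entries strictly decreasing down columns, each nonzero entry in column $j$ at most $n+m'-j$; $\mathcal{C}^{\mathrm{col}}_{n,m'}$ is the subset of those $c$ all of whose columns have even length; $V^C(c)$ is the number of columns of odd length. $\mathcal{T}_{n,m'}$ is the set of integer arrays $b=(b_{ij})_{1\le i\le j\le n+m'-1}$ weakly decreasing along rows and columns with $\max\{n-i,0\}\le b_{ij}\le n$; $\Phi_{n,m'}(c)=b$ with $b_{ij}=n-\#\{l:c_{n+m'-j,l}\ge1-i+j\}$; with $b_{i,n+m'}=n-i$, $b_{0,j}=n$, $U_r(b)=\sum_{s=1}^{n+m'-r}(b_{s,s+r-1}-b_{s,s+r})+\sum_{s=n+m'-r+1}^{n+m'-1}\chi\{b_{s,n+m'-1}>n-s\}$, and for $c\in\mathcal{C}_{n,m'}$, $\overline U_r(c)=n+m'-1-U_r(\Phi_{n,m'}(c))$. -}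

module Defs where

open import Data.Nat as ℕ using (ℕ; zero; suc; _+_; _∸_; _≤ᵇ_; _<ᵇ_; _≡ᵇ_; _%_)
open import Data.Integer as ℤ using (ℤ; +_)
open import Data.Bool using (Bool; true; false; _∧_; not; if_then_else_; T)
open import Data.List using (List; []; _∷_; length; map; upTo; foldr)
open import Data.Vec using (Vec; toList)
open import Data.Product using (Σ)
open import Relation.Nullary using (does)
open import Data.Integer.Properties using (_<?_)
open import Relation.Binary.PropositionalEquality using (_≡_)
open import Function.Bundles using (_↔_)

-- Representation of plane partitions with at most n nonzero columns.
-- An element c : Array n is the vector of its first n columns; column j
-- (1-based) is given by the list of its NONZERO entries read top to
-- bottom.  All columns beyond n are zero.  (Since nonzero entries of a
-- plane partition form a prefix of each column, this is a bijective
-- encoding once all listed entries are required to be ≥ 1.)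

Array : ℕ → Set
Array n = Vec (List ℕ) n

atD : {A : Set} → A → List A → ℕ → A
atD d []       _       = d
atD d (x ∷ _)  zero    = x
atD d (_ ∷ xs) (suc k) = atD d xs k

-- c_{i,l}, 1-based row i and column l; 0 outside the stored entries
entry : {n : ℕ} → Array n → ℕ → ℕ → ℕ
entry c zero    l       = 0
entry c (suc i) zero    = 0
entry c (suc i) (suc l) = atD 0 (atD [] (toList c) l) i

strictDecPos : List ℕ → Bool
strictDecPos []            = true
strictDecPos (x ∷ [])      = 1 ≤ᵇ x
strictDecPos (x ∷ y ∷ t)   = (y <ᵇ x) ∧ strictDecPos (y ∷ t)

allLe : ℕ → List ℕ → Bool
allLe b xs = foldr (λ x acc → (x ≤ᵇ b) ∧ acc) true xs

dominates : List ℕ → List ℕ → Bool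
dominates _        []       = true
dominates []       (_ ∷ _)  = false
dominates (x ∷ xs) (y ∷ ys) = (y ≤ᵇ x) ∧ dominates xs ys

dominatesNext : List ℕ → List (List ℕ) → Bool
dominatesNext _   []          = true
dominatesNext col (nxt ∷ _)   = dominates col nxt

checkCols : (n m' j : ℕ) → List (List ℕ) → Bool
checkCols n m' j []           = true
checkCols n m' j (col ∷ rest) =
  strictDecPos col ∧ allLe (n + m' ∸ j) col ∧ dominatesNext col rest
  ∧ checkCols n m' (suc j) rest

isC : (n m' : ℕ) → Array n → Bool
isC n m' c = checkCols n m' 1 (toList c)

isEven : ℕ → Bool
isEven k = k % 2 ≡ᵇ 0

allColsEven : {n : ℕ} → Array n → Bool
allColsEven c = foldr (λ col acc → isEven (length col) ∧ acc) true (toList c)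

CSet : (n m' : ℕ) → Set
CSet n m' = Σ (Array n) (λ c → T (isC n m' c))

CcolSet : (n m' : ℕ) → Set
CcolSet n m' = Σ (Array n) (λ c → T (isC n m' c ∧ allColsEven c))

countTrue : List Bool → ℕ
countTrue []           = 0
countTrue (true ∷ bs)  = suc (countTrue bs)
countTrue (false ∷ bs) = countTrue bs

VC : {n : ℕ} → Array n → ℕ
VC c = countTrue (map (λ col → not (isEven (length col))) (toList c))

range : ℕ → ℕ → List ℕ
range a b = map (λ k → a + k) (upTo (suc b ∸ a))

sumℤ : List ℤ → ℤ
sumℤ = foldr ℤ._+_ (+ 0)

-- Φ_{n,m'}(c)_{ij} = n - #{l : c_{n+m'-j,l} ≥ 1-i+j}   (1 ≤ i ≤ j ≤ n+m'-1)
-- (only l ∈ [1..n] can contribute since 1-i+j ≥ 1 and other columns are 0)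
Φ : (n m' : ℕ) → Array n → ℕ → ℕ → ℤ
Φ n m' c i j =
  + n ℤ.- + countTrue (map (λ l → suc j ∸ i ≤ᵇ entry c (n + m' ∸ j) l) (range 1 n))

bExt : (n m' : ℕ) → Array n → ℕ → ℕ → ℤ
bExt n m' c zero    j = + n
bExt n m' c (suc i) j =
  if j ≡ᵇ n + m' then + n ℤ.- + suc i else Φ n m' c (suc i) j

χ : Bool → ℤ
χ true  = + 1
χ false = + 0

U : (n m' r : ℕ) → Array n → ℤ
U n m' r c =
  sumℤ (map (λ s → bExt n m' c s (s + r ∸ 1) ℤ.- bExt n m' c s (s + r))
            (range 1 (n + m' ∸ r)))
  ℤ.+
  sumℤ (map (λ s → χ (does ((+ n ℤ.- + s) <? bExt n m' c s (n + m' ∸ 1))))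
            (range (suc (n + m' ∸ r)) (n + m' ∸ 1)))

Ubar : (n m' r : ℕ) → Array n → ℤ
Ubar n m' r c = + (n + m' ∸ 1) ℤ.- U n m' r c

-- Equality of generating functions  Σ_{a∈A} t^{f a} = Σ_{b∈B} t^{g b}
-- for finite sets A, B: for every exponent k the fibres have the same
-- cardinality, expressed as an explicit bijection.

SameGenFun : (A B : Set) → (A → ℤ) → (B → ℤ) → Set
SameGenFun A B f g = (k : ℤ) → Σ A (λ a → f a ≡ k) ↔ Σ B (λ b → g b ≡ k)

module Submission where

open import Defs
open import Data.Nat as ℕ
  using (ℕ; zero; suc; _+_; _∸_; _≤_; _<_; z≤n; s≤s; s≤s⁻¹; z<s; _≤ᵇ_; _<ᵇ_; _≡ᵇ_; _⊔_; _⊓_; _%_; pred)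
open import Data.Nat.Properties
open import Data.Nat.DivMod using ([m+n]%n≡m%n)
import Data.Nat.Tactic.RingSolver as ℕ-Solver
open import Data.Integer as ℤ using (ℤ; +_) renaming (_+_ to _+ℤ_; _-_ to _-ℤ_)
import Data.Integer.Properties as ℤ
import Data.Integer.Tactic.RingSolver as ℤ-Solver
open import Data.Bool using (Bool; true; false; _∧_; not; if_then_else_; T)
open import Data.Bool.Properties using (T-∧; T-≡; T-irrelevant; ∧-zeroʳ)
open import Data.Unit using (tt)
open import Data.List as List using (List; []; _∷_; length; map; upTo; applyUpTo; _++_)
import Data.List.Properties as List
open import Data.List.Relation.Unary.All as All using (All; []; _∷_)
import Data.List.Relation.Unary.All.Properties as All
open import Data.Vec as Vec using (Vec; toList)
import Data.Vec.Properties as Vec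
open import Data.Product using (Σ; _,_; proj₁; proj₂; _×_)
open import Data.Sum as Sum using (_⊎_; inj₁; inj₂)
open import Data.Empty using (⊥; ⊥-elim)
open import Function using (_∘_; _∋_)
open import Function.Bundles using (_↔_; mk↔ₛ′; Equivalence)
open import Relation.Nullary using (yes; no; does)
open import Relation.Binary.PropositionalEquality
open import Axiom.UniquenessOfIdentityProofs using (module Decidable⇒UIP)

-- Read off c, Ū_r(c) is the number of entries equal to r plus the number of
-- u ∈ [1, r) for which the top row of c holds the largest possible number
-- n + m′ − u of entries ≥ u.  A Bender–Knuth involution exchanging the values
-- r and r + 1 maps this statistic for r to the one for r + 1; it keeps column
-- lengths, so it acts on 𝒞_{n,m′} and on 𝒞^col_{n,m′}, and all Ū_r with
-- 1 ≤ r ≤ n + m′ are equidistributed on either set.  Adding one to every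
-- entry and closing every odd column with a 1 is a bijection
-- 𝒞_{n,m} → 𝒞^col_{n,m+1}; it turns Ū_{n+m} into Ū_{n+m+1} and V^C into Ū_1.

≤ᵇ-true : ∀ {m n} → m ≤ n → (m ≤ᵇ n) ≡ true
≤ᵇ-true m≤n = Equivalence.to T-≡ (≤⇒≤ᵇ m≤n)

≤ᵇ-false : ∀ {m n} → n < m → (m ≤ᵇ n) ≡ false
≤ᵇ-false {m} {n} n<m with m ≤ᵇ n in eq
... | false = refl
... | true  = ⊥-elim (<⇒≱ n<m (≤ᵇ⇒≤ m n (subst T (sym eq) tt)))

≤ᵇ-true⁻¹ : ∀ {m n} → (m ≤ᵇ n) ≡ true → m ≤ n
≤ᵇ-true⁻¹ {m} {n} eq = ≤ᵇ⇒≤ m n (subst T (sym eq) tt)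

≡ᵇ-false : ∀ {m n} → m < n → (m ≡ᵇ n) ≡ false
≡ᵇ-false {m} {n} m<n with m ≡ᵇ n in eq
... | false = refl
... | true  = ⊥-elim (<-irrefl (≡ᵇ⇒≡ m n (subst T (sym eq) tt)) m<n)

≡ᵇ-refl : ∀ n → (n ≡ᵇ n) ≡ true
≡ᵇ-refl n = Equivalence.to T-≡ (≡⇒≡ᵇ n n refl)

T-∧⁻ : ∀ {a b} → T (a ∧ b) → T a × T b
T-∧⁻ = Equivalence.to T-∧

T-∧⁺ : ∀ {a b} → T a → T b → T (a ∧ b)
T-∧⁺ p q = Equivalence.from T-∧ (p , q)

m∸n>0⇒n<m : ∀ {m n} → 0 < m ∸ n → n < m
m∸n>0⇒n<m 0<m∸n = m∸n≢0⇒n<m (λ m∸n≡0 → <-irrefl (sym m∸n≡0) 0<m∸n)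

∸≡suc∸suc : ∀ {m n} → n < m → m ∸ n ≡ suc (m ∸ suc n)
∸≡suc∸suc {m} {n} n<m = +-∸-assoc 1 {m} {suc n} n<m

+≡⇒∸≡ : ∀ {a b c} → a + b ≡ c → c ∸ b ≡ a
+≡⇒∸≡ {a} {b} refl = m+n∸n≡m a b

∸-swap-≤ : ∀ {m a b} → m ∸ suc a ≤ b → m ∸ suc b ≤ a
∸-swap-≤ {m} {a} {b} m∸sa≤b = m≤n+o⇒m∸n≤o m (suc b) (begin
    m                      ≤⟨ m≤n+m∸n m (suc a) ⟩
    suc a + (m ∸ suc a)    ≤⟨ +-monoʳ-≤ (suc a) m∸sa≤b ⟩
    suc a + b              ≡⟨ cong suc (+-comm a b) ⟩
    suc b + a              ∎)
  where open ≤-Reasoning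

∸-swap-< : ∀ {m a b} → b < m ∸ suc a → suc a ≤ m ∸ suc b
∸-swap-< {m} {a} {b} b<m∸sa = m+n≤o⇒m≤o∸n (suc a) (begin
    suc a + suc b          ≡⟨ +-comm (suc a) (suc b) ⟩
    suc b + suc a          ≤⟨ +-monoˡ-≤ (suc a) b<m∸sa ⟩
    m ∸ suc a + suc a      ≡⟨ m∸n+n≡m (<⇒≤ (m∸n>0⇒n<m {m} {suc a} (≤-<-trans z≤n b<m∸sa))) ⟩
    m                      ∎)
  where open ≤-Reasoning

<⊔⇒<⊎< : ∀ {l x y} → l < x ⊔ y → l < x ⊎ l < y
<⊔⇒<⊎< {l} {x} {y} l<x⊔y with ⊔-sel x y
... | inj₁ x⊔y≡x = inj₁ (subst (l <_) x⊔y≡x l<x⊔y)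
... | inj₂ x⊔y≡y = inj₂ (subst (l <_) x⊔y≡y l<x⊔y)

⊓≤⇒≤⊎≤ : ∀ {l x y} → x ⊓ y ≤ l → x ≤ l ⊎ y ≤ l
⊓≤⇒≤⊎≤ {l} {x} {y} x⊓y≤l with ⊓-sel x y
... | inj₁ x⊓y≡x = inj₁ (subst (_≤ l) x⊓y≡x x⊓y≤l)
... | inj₂ x⊓y≡y = inj₂ (subst (_≤ l) x⊓y≡y x⊓y≤l)

m⊔n+n⊓m≡m+n : ∀ m n → m ⊔ n + n ⊓ m ≡ m + n
m⊔n+n⊓m≡m+n m n with ≤-total m n
... | inj₁ m≤n rewrite m≤n⇒m⊔n≡n m≤n | m≥n⇒m⊓n≡n m≤n = +-comm n m
... | inj₂ n≤m rewrite m≥n⇒m⊔n≡m n≤m | m≤n⇒m⊓n≡m n≤m = refl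

diff-exchange : ∀ {x y a b d} f → x + y + d ≡ a + b → (+ x -ℤ + a) +ℤ + (f + d) ≡ (+ b -ℤ + y) +ℤ + f
diff-exchange {x} {y} {a} {b} {d} f x+y+d≡a+b = begin
    (+ x -ℤ + a) +ℤ + (f + d)              ≡⟨ cong ((+ x -ℤ + a) +ℤ_) (ℤ.pos-+ f d) ⟩
    (+ x -ℤ + a) +ℤ (+ f +ℤ + d)           ≡⟨ regroup (+ x) (+ y) (+ a) (+ f) (+ d) ⟩
    ((+ x +ℤ + y) +ℤ + d) -ℤ + a -ℤ + y +ℤ + f  ≡⟨ cong (λ z → z -ℤ + a -ℤ + y +ℤ + f) sides ⟩
    (+ a +ℤ + b) -ℤ + a -ℤ + y +ℤ + f      ≡⟨ regroup′ (+ y) (+ a) (+ b) (+ f) ⟩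
    (+ b -ℤ + y) +ℤ + f                    ∎
  where
  open ≡-Reasoning
  regroup : ∀ x y a f d → (x -ℤ a) +ℤ (f +ℤ d) ≡ ((x +ℤ y) +ℤ d) -ℤ a -ℤ y +ℤ f
  regroup = ℤ-Solver.solve-∀
  regroup′ : ∀ y a b f → (a +ℤ b) -ℤ a -ℤ y +ℤ f ≡ (b -ℤ y) +ℤ f
  regroup′ = ℤ-Solver.solve-∀
  sides : (+ x +ℤ + y) +ℤ + d ≡ + a +ℤ + b
  sides = begin
    (+ x +ℤ + y) +ℤ + d   ≡⟨ sym (trans (ℤ.pos-+ (x + y) d) (cong (_+ℤ + d) (ℤ.pos-+ x y))) ⟩
    + (x + y + d)         ≡⟨ cong +_ x+y+d≡a+b ⟩
    + (a + b)             ≡⟨ ℤ.pos-+ a b ⟩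
    + a +ℤ + b            ∎

boolToℕ : Bool → ℕ
boolToℕ false = 0
boolToℕ true  = 1

sum< : (ℕ → ℕ) → ℕ → ℕ
sum< f zero    = 0
sum< f (suc k) = sum< f k + f k

sumℤ< : (ℕ → ℤ) → ℕ → ℤ
sumℤ< f zero    = + 0
sumℤ< f (suc k) = sumℤ< f k +ℤ f k

count< : (ℕ → Bool) → ℕ → ℕ
count< P = sum< (boolToℕ ∘ P)

sum<-cong : ∀ {f g} k → (∀ i → i < k → f i ≡ g i) → sum< f k ≡ sum< g k
sum<-cong zero    _ = refl
sum<-cong (suc k) e = cong₂ _+_ (sum<-cong k (λ i i<k → e i (m<n⇒m<1+n i<k))) (e k (n<1+n k))

sumℤ<-cong : ∀ {f g} k → (∀ i → i < k → f i ≡ g i) → sumℤ< f k ≡ sumℤ< g k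
sumℤ<-cong zero    _ = refl
sumℤ<-cong (suc k) e = cong₂ _+ℤ_ (sumℤ<-cong k (λ i i<k → e i (m<n⇒m<1+n i<k))) (e k (n<1+n k))

count<-cong : ∀ {P Q} k → (∀ i → i < k → P i ≡ Q i) → count< P k ≡ count< Q k
count<-cong k e = sum<-cong k (λ i i<k → cong boolToℕ (e i i<k))

sum<-vanish : ∀ {f} k → (∀ i → i < k → f i ≡ 0) → sum< f k ≡ 0
sum<-vanish zero    _ = refl
sum<-vanish (suc k) e = cong₂ _+_ (sum<-vanish k (λ i i<k → e i (m<n⇒m<1+n i<k))) (e k (n<1+n k))

sum<-+ : ∀ f g k → sum< (λ i → f i + g i) k ≡ sum< f k + sum< g k
sum<-+ f g zero    = refl
sum<-+ f g (suc k) = trans (cong (_+ (f k + g k)) (sum<-+ f g k)) (interchange (sum< f k) (sum< g k) (f k) (g k))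
  where interchange : ∀ a b c d → (a + b) + (c + d) ≡ (a + c) + (b + d)
        interchange = ℕ-Solver.solve-∀

sum<-swap : ∀ (f : ℕ → ℕ → ℕ) j k →
            sum< (λ a → sum< (f a) k) j ≡ sum< (λ b → sum< (λ a → f a b) j) k
sum<-swap f zero    k = sym (sum<-vanish k (λ _ _ → refl))
sum<-swap f (suc j) k = trans (cong (_+ sum< (f j) k) (sum<-swap f j k))
                              (sym (sum<-+ (λ b → sum< (λ a → f a b) j) (f j) k))

sum<-sucˡ : ∀ f k → sum< f (suc k) ≡ f 0 + sum< (f ∘ suc) k
sum<-sucˡ f zero    = +-comm 0 (f 0)
sum<-sucˡ f (suc k) = trans (cong (_+ f (suc k)) (sum<-sucˡ f k)) (+-assoc (f 0) _ _)

sumℤ<-sucˡ : ∀ f k → sumℤ< f (suc k) ≡ f 0 +ℤ sumℤ< (f ∘ suc) k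
sumℤ<-sucˡ f zero    = trans (ℤ.+-identityˡ (f 0)) (sym (ℤ.+-identityʳ (f 0)))
sumℤ<-sucˡ f (suc k) = trans (cong (_+ℤ f (suc k)) (sumℤ<-sucˡ f k)) (ℤ.+-assoc (f 0) _ _)

sumℤ<-reverse : ∀ f k → sumℤ< f k ≡ sumℤ< (λ i → f (k ∸ suc i)) k
sumℤ<-reverse f zero    = refl
sumℤ<-reverse f (suc k) = trans (cong (_+ℤ f k) (sumℤ<-reverse f k))
  (trans (ℤ.+-comm _ (f k)) (sym (sumℤ<-sucˡ (λ i → f (suc k ∸ suc i)) k)))

sumℤ<-diff : ∀ f g k → sumℤ< (λ i → + f i -ℤ + g i) k ≡ + sum< f k -ℤ + sum< g k
sumℤ<-diff f g zero    = refl
sumℤ<-diff f g (suc k) = begin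
    sumℤ< (λ i → + f i -ℤ + g i) k +ℤ (+ f k -ℤ + g k)
  ≡⟨ cong (_+ℤ (+ f k -ℤ + g k)) (sumℤ<-diff f g k) ⟩
    (+ sum< f k -ℤ + sum< g k) +ℤ (+ f k -ℤ + g k)
  ≡⟨ regroup (+ sum< f k) (+ sum< g k) (+ f k) (+ g k) ⟩
    (+ sum< f k +ℤ + f k) -ℤ (+ sum< g k +ℤ + g k)
  ≡⟨ sym (cong₂ _-ℤ_ (ℤ.pos-+ (sum< f k) (f k)) (ℤ.pos-+ (sum< g k) (g k))) ⟩
    + sum< f (suc k) -ℤ + sum< g (suc k) ∎
  where
  open ≡-Reasoning
  regroup : ∀ a b c d → (a -ℤ b) +ℤ (c -ℤ d) ≡ (a +ℤ c) -ℤ (b +ℤ d)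
  regroup = ℤ-Solver.solve-∀

sum<-zero-tail : ∀ f {j k} → j ≤ k → (∀ i → j ≤ i → i < k → f i ≡ 0) → sum< f k ≡ sum< f j
sum<-zero-tail f {k = zero}  z≤n _ = refl
sum<-zero-tail f {j} {suc k} j≤1+k e with m≤n⇒m<n∨m≡n j≤1+k
... | inj₂ refl      = refl
... | inj₁ (s≤s j≤k) = trans (cong (_+_ (sum< f k)) (e k j≤k (n<1+n k)))
  (trans (+-identityʳ _) (sum<-zero-tail f j≤k (λ i j≤i i<k → e i j≤i (m<n⇒m<1+n i<k))))

count<-≤ : ∀ P k → count< P k ≤ k
count<-≤ P zero    = z≤n
count<-≤ P (suc k) = subst (_≤ suc k) (+-comm (boolToℕ (P k)) _)
                           (+-mono-≤ (boolToℕ≤1 (P k)) (count<-≤ P k))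
  where boolToℕ≤1 : ∀ b → boolToℕ b ≤ 1
        boolToℕ≤1 false = z≤n
        boolToℕ≤1 true  = s≤s z≤n

count<-true : ∀ P k → (∀ i → i < k → P i ≡ true) → count< P k ≡ k
count<-true P zero    _ = refl
count<-true P (suc k) e
  rewrite e k (n<1+n k) | count<-true P k (λ i i<k → e i (m<n⇒m<1+n i<k)) = +-comm k 1

count<-false : ∀ P k → (∀ i → i < k → P i ≡ false) → count< P k ≡ 0
count<-false P k e = sum<-vanish k (λ i i<k → cong boolToℕ (e i i<k))

count<-initial : ∀ P {p} k → p ≤ k → (∀ i → i < k → P i ≡ (i <ᵇ p)) → count< P k ≡ p
count<-initial P zero    z≤n _ = refl
count<-initial P {p} (suc k) p≤1+k e with m≤n⇒m<n∨m≡n p≤1+k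
... | inj₂ refl      = count<-true P (suc k) (λ i i<p → trans (e i i<p) (≤ᵇ-true i<p))
... | inj₁ (s≤s p≤k) = begin
    count< P k + boolToℕ (P k)
  ≡⟨ cong₂ _+_ (count<-initial P k p≤k (λ i i<k → e i (m<n⇒m<1+n i<k)))
               (cong boolToℕ (trans (e k (n<1+n k)) (≤ᵇ-false (s≤s p≤k)))) ⟩
    p + 0
  ≡⟨ +-identityʳ p ⟩
    p ∎
  where open ≡-Reasoning

DownClosed : (ℕ → Bool) → Set
DownClosed P = ∀ i → P (suc i) ≡ true → P i ≡ true

downClosed-≤ : ∀ {P} → DownClosed P → ∀ {i j} → i ≤ j → P j ≡ true → P i ≡ true
downClosed-≤ dc {i} {j} i≤j Pj with m≤n⇒m<n∨m≡n i≤j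
... | inj₂ refl = Pj
downClosed-≤ dc {j = suc j} _ Pj | inj₁ (s≤s i≤j) = downClosed-≤ dc i≤j (dc j Pj)

count<-downClosed : ∀ {P} → DownClosed P → ∀ k i → i < k → P i ≡ (i <ᵇ count< P k)
count<-downClosed {P} dc (suc k) i i<1+k with P k in Pk
... | true = begin
    P i                     ≡⟨ downClosed-≤ dc (s≤s⁻¹ i<1+k) Pk ⟩
    true                    ≡⟨ sym (≤ᵇ-true i<1+k) ⟩
    (i <ᵇ suc k)            ≡⟨ sym (cong (i <ᵇ_) (trans (+-comm (count< P k) 1)
                                 (cong suc (count<-true P k (λ j j<k → downClosed-≤ dc (<⇒≤ j<k) Pk))))) ⟩
    (i <ᵇ count< P k + 1)   ∎
  where open ≡-Reasoning
... | false with m≤n⇒m<n∨m≡n (s≤s⁻¹ i<1+k)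
...   | inj₁ i<k  = trans (count<-downClosed dc k i i<k) (cong (i <ᵇ_) (sym (+-identityʳ (count< P k))))
...   | inj₂ refl = trans Pk (sym (trans (cong (i <ᵇ_) (+-identityʳ (count< P i))) (≤ᵇ-false (s≤s (count<-≤ P i)))))

at : List ℕ → ℕ → ℕ
at = atD 0

column : List (List ℕ) → ℕ → List ℕ
column = atD []

at-beyond : ∀ xs {i} → length xs ≤ i → at xs i ≡ 0
at-beyond []       _         = refl
at-beyond (x ∷ xs) (s≤s len≤i) = at-beyond xs len≤i

Positive : List ℕ → Set
Positive xs = ∀ i → i < length xs → 1 ≤ at xs i

StrictlyDecreasing : List ℕ → Set
StrictlyDecreasing xs = ∀ i → 1 ≤ at xs (suc i) → at xs (suc i) < at xs i

strictDecPos-positive : ∀ xs → T (strictDecPos xs) → Positive xs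
strictDecPos-positive (x ∷ [])    h zero    _ = ≤ᵇ⇒≤ 1 x h
strictDecPos-positive (x ∷ [])    h (suc i) (s≤s ())
strictDecPos-positive (x ∷ y ∷ t) h zero    _ = <-≤-trans z<s (<ᵇ⇒< y x (proj₁ (T-∧⁻ {y <ᵇ x} h)))
strictDecPos-positive (x ∷ y ∷ t) h (suc i) (s≤s i<len) =
  strictDecPos-positive (y ∷ t) (proj₂ (T-∧⁻ {y <ᵇ x} h)) i i<len

strictDecPos-decreasing : ∀ xs → T (strictDecPos xs) → StrictlyDecreasing xs
strictDecPos-decreasing (x ∷ y ∷ t) h zero    _ = <ᵇ⇒< y x (proj₁ (T-∧⁻ {y <ᵇ x} h))
strictDecPos-decreasing (x ∷ y ∷ t) h (suc i) p =
  strictDecPos-decreasing (y ∷ t) (proj₂ (T-∧⁻ {y <ᵇ x} h)) i p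

strictDecPos-complete : ∀ xs → Positive xs → StrictlyDecreasing xs → T (strictDecPos xs)
strictDecPos-complete []          _   _   = tt
strictDecPos-complete (x ∷ [])    pos _   = ≤⇒≤ᵇ (pos 0 z<s)
strictDecPos-complete (x ∷ y ∷ t) pos dec =
  T-∧⁺ (<⇒<ᵇ (dec 0 (pos 1 (s≤s z<s))))
       (strictDecPos-complete (y ∷ t) (λ i i<len → pos (suc i) (s≤s i<len)) (λ i → dec (suc i)))

allLe-sound : ∀ b xs → T (allLe b xs) → ∀ i → at xs i ≤ b
allLe-sound b []       _ i       = z≤n
allLe-sound b (x ∷ xs) h zero    = ≤ᵇ⇒≤ x b (proj₁ (T-∧⁻ {x ≤ᵇ b} h))
allLe-sound b (x ∷ xs) h (suc i) = allLe-sound b xs (proj₂ (T-∧⁻ {x ≤ᵇ b} h)) i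

allLe-complete : ∀ b xs → (∀ i → at xs i ≤ b) → T (allLe b xs)
allLe-complete b []       _ = tt
allLe-complete b (x ∷ xs) h = T-∧⁺ (≤⇒≤ᵇ (h 0)) (allLe-complete b xs (h ∘ suc))

dominates-sound : ∀ xs ys → T (dominates xs ys) → ∀ i → at ys i ≤ at xs i
dominates-sound xs       []       _ i       = z≤n
dominates-sound (x ∷ xs) (y ∷ ys) h zero    = ≤ᵇ⇒≤ y x (proj₁ (T-∧⁻ {y ≤ᵇ x} h))
dominates-sound (x ∷ xs) (y ∷ ys) h (suc i) = dominates-sound xs ys (proj₂ (T-∧⁻ {y ≤ᵇ x} h)) i

dominates-complete : ∀ xs ys → Positive ys → (∀ i → at ys i ≤ at xs i) → T (dominates xs ys)
dominates-complete xs       []       _   _ = tt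
dominates-complete []       (y ∷ ys) pos h = ⊥-elim (<⇒≱ (pos 0 z<s) (h 0))
dominates-complete (x ∷ xs) (y ∷ ys) pos h =
  T-∧⁺ (≤⇒≤ᵇ (h 0)) (dominates-complete xs ys (λ i i<len → pos (suc i) (s≤s i<len)) (h ∘ suc))

-- The listed columns are the columns j, j + 1, … of the paper.
record ValidColumns (N j : ℕ) (cs : List (List ℕ)) : Set where
  field
    positive     : ∀ l → Positive (column cs l)
    decreasing   : ∀ l → StrictlyDecreasing (column cs l)
    bounded      : ∀ l i → at (column cs l) i ≤ N ∸ (j + l)
    rowsDecrease : ∀ l i → at (column cs (suc l)) i ≤ at (column cs l) i
open ValidColumns public

checkCols-sound : ∀ n m' j cs → T (checkCols n m' j cs) → ValidColumns (n + m') j cs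
checkCols-sound n m' j [] _ = record
  { positive = λ { zero _ () ; (suc _) _ () } ; decreasing = λ { zero _ () ; (suc _) _ () }
  ; bounded = λ { zero _ → z≤n ; (suc _) _ → z≤n } ; rowsDecrease = λ { zero _ → z≤n ; (suc _) _ → z≤n } }
checkCols-sound n m' j (col ∷ rest) h = record
  { positive     = λ { zero → strictDecPos-positive col sdp ; (suc l) → positive valid l }
  ; decreasing   = λ { zero → strictDecPos-decreasing col sdp ; (suc l) → decreasing valid l }
  ; bounded      = λ { zero i → subst (λ k → at col i ≤ n + m' ∸ k) (sym (+-identityʳ j)) (allLe-sound _ col le i)
                     ; (suc l) i → subst (λ k → at (column rest l) i ≤ n + m' ∸ k) (sym (+-suc j l)) (bounded valid l i) }
  ; rowsDecrease = λ { zero → next-dominated rest dom ; (suc l) → rowsDecrease valid l } }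
  where
  sdp : T (strictDecPos col)
  sdp = proj₁ (T-∧⁻ {strictDecPos col} h)
  h′ : T (allLe (n + m' ∸ j) col ∧ dominatesNext col rest ∧ checkCols n m' (suc j) rest)
  h′ = proj₂ (T-∧⁻ {strictDecPos col} h)
  le : T (allLe (n + m' ∸ j) col)
  le = proj₁ (T-∧⁻ {allLe (n + m' ∸ j) col} h′)
  h″ : T (dominatesNext col rest ∧ checkCols n m' (suc j) rest)
  h″ = proj₂ (T-∧⁻ {allLe (n + m' ∸ j) col} h′)
  dom : T (dominatesNext col rest)
  dom = proj₁ (T-∧⁻ {dominatesNext col rest} h″)
  valid : ValidColumns (n + m') (suc j) rest
  valid = checkCols-sound n m' (suc j) rest (proj₂ (T-∧⁻ {dominatesNext col rest} h″))
  next-dominated : ∀ rest → T (dominatesNext col rest) → ∀ i → at (column rest 0) i ≤ at col i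
  next-dominated []        _ i = z≤n
  next-dominated (nxt ∷ _) d i = dominates-sound col nxt d i

checkCols-complete : ∀ n m' j cs → ValidColumns (n + m') j cs → T (checkCols n m' j cs)
checkCols-complete n m' j []           _     = tt
checkCols-complete n m' j (col ∷ rest) valid =
  T-∧⁺ (strictDecPos-complete col (positive valid 0) (decreasing valid 0))
  (T-∧⁺ (allLe-complete _ col (λ i → subst (λ k → at col i ≤ n + m' ∸ k) (+-identityʳ j) (bounded valid 0 i)))
  (T-∧⁺ (next-dominates rest (rowsDecrease valid 0) (positive valid 1))
        (checkCols-complete n m' (suc j) rest record
          { positive     = positive valid ∘ suc
          ; decreasing   = decreasing valid ∘ suc
          ; bounded      = λ l i → subst (λ k → at (column rest l) i ≤ n + m' ∸ k) (+-suc j l) (bounded valid (suc l) i)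
          ; rowsDecrease = rowsDecrease valid ∘ suc })))
  where
  next-dominates : ∀ rest → (∀ i → at (column rest 0) i ≤ at col i) → Positive (column rest 0) →
                   T (dominatesNext col rest)
  next-dominates []        _ _   = tt
  next-dominates (nxt ∷ _) h pos = dominates-complete col nxt pos h

InC : (n m' : ℕ) → Array n → Set
InC n m' c = ValidColumns (n + m') 1 (toList c)

isC⇒InC : ∀ {n m'} c → T (isC n m' c) → InC n m' c
isC⇒InC {n} {m'} c = checkCols-sound n m' 1 (toList c)

InC⇒isC : ∀ {n m'} c → InC n m' c → T (isC n m' c)
InC⇒isC {n} {m'} c = checkCols-complete n m' 1 (toList c)

-- Rows and columns are counted from 0: cell c i l is the paper's c_{i+1,l+1}.
cell : ∀ {n} → Array n → ℕ → ℕ → ℕ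
cell c i l = at (column (toList c) l) i

row≥ : ∀ {n} → Array n → ℕ → ℕ → ℕ
row≥ {n} c i v = count< (λ l → v ≤ᵇ cell c i l) n

column-beyond : ∀ (cs : List (List ℕ)) {l} → length cs ≤ l → column cs l ≡ []
column-beyond []       _           = refl
column-beyond (_ ∷ cs) (s≤s len≤l) = column-beyond cs len≤l

cell-beyond : ∀ {n} (c : Array n) i {l} → n ≤ l → cell c i l ≡ 0
cell-beyond c i n≤l
  rewrite column-beyond (toList c) (subst (_≤ _) (sym (Vec.length-toList c)) n≤l) = refl

module _ {n m' : ℕ} {c : Array n} (valid : InC n m' c) where

  row≥-downClosed : ∀ i v → DownClosed (λ l → v ≤ᵇ cell c i l)
  row≥-downClosed i v l h = ≤ᵇ-true (≤-trans (≤ᵇ-true⁻¹ {v} h) (rowsDecrease valid l i))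

  <row≥⇒≤cell : ∀ {v} i l → l < row≥ c i v → v ≤ cell c i l
  <row≥⇒≤cell {v} i l l<row = ≤ᵇ-true⁻¹ {v} (begin
      (v ≤ᵇ cell c i l)      ≡⟨ count<-downClosed (row≥-downClosed i v) n l l<n ⟩
      (l <ᵇ row≥ c i v)      ≡⟨ ≤ᵇ-true l<row ⟩
      true                   ∎)
    where
    open ≡-Reasoning
    l<n : l < n
    l<n = <-≤-trans l<row (count<-≤ _ n)

  ≤cell⇒<row≥ : ∀ {v} i l → 1 ≤ v → v ≤ cell c i l → l < row≥ c i v
  ≤cell⇒<row≥ {v} i l 1≤v v≤cell with l ℕ.<? n
  ... | no  l≮n = ⊥-elim (<⇒≱ 1≤v (subst (v ≤_) (cell-beyond c i (≮⇒≥ l≮n)) v≤cell))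
  ... | yes l<n = ≤ᵇ-true⁻¹ {suc l} (begin
      (l <ᵇ row≥ c i v)      ≡⟨ sym (count<-downClosed (row≥-downClosed i v) n l l<n) ⟩
      (v ≤ᵇ cell c i l)      ≡⟨ ≤ᵇ-true v≤cell ⟩
      true                   ∎)
    where open ≡-Reasoning

  row≥≤⇒cell< : ∀ {v} i l → 1 ≤ v → row≥ c i v ≤ l → cell c i l < v
  row≥≤⇒cell< i l 1≤v row≤l = ≰⇒> (λ v≤cell → <⇒≱ (≤cell⇒<row≥ i l 1≤v v≤cell) row≤l)

  cell-bound : ∀ i l → 1 ≤ cell c i l → cell c i l + i + suc l ≤ n + m'
  cell-bound zero l 1≤cell = begin
      cell c 0 l + 0 + suc l      ≡⟨ cong (_+ suc l) (+-identityʳ _) ⟩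
      cell c 0 l + suc l          ≤⟨ +-monoˡ-≤ (suc l) (bounded valid l 0) ⟩
      n + m' ∸ suc l + suc l      ≡⟨ m∸n+n≡m (<⇒≤ (m∸n>0⇒n<m {n + m'} {suc l} (≤-trans 1≤cell (bounded valid l 0)))) ⟩
      n + m'                      ∎
    where open ≤-Reasoning
  cell-bound (suc i) l 1≤cell = begin
      cell c (suc i) l + suc i + suc l  ≡⟨ cong (_+ suc l) (+-suc (cell c (suc i) l) i) ⟩
      suc (cell c (suc i) l) + i + suc l ≤⟨ +-monoˡ-≤ (suc l) (+-monoˡ-≤ i below) ⟩
      cell c i l + i + suc l            ≤⟨ cell-bound i l (<-≤-trans z<s below) ⟩
      n + m'                            ∎
    where
    open ≤-Reasoning
    below : cell c (suc i) l < cell c i l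
    below = decreasing valid l i 1≤cell

  row≥-vanish : ∀ i v → 1 ≤ v → n + m' ≤ i + v → row≥ c i v ≡ 0
  row≥-vanish i v 1≤v N≤i+v = count<-false _ n (λ l _ → ≤ᵇ-false (≰⇒> (too-big l)))
    where
    too-big : ∀ l → v ≤ cell c i l → ⊥
    too-big l v≤cell = <⇒≱ (begin-strict
        n + m'                   ≤⟨ N≤i+v ⟩
        i + v                    ≡⟨ +-comm i v ⟩
        v + i                    ≤⟨ +-monoˡ-≤ i v≤cell ⟩
        cell c i l + i           <⟨ m<m+n _ z<s ⟩
        cell c i l + i + suc l   ∎)
      (cell-bound i l (≤-trans 1≤v v≤cell))
      where open ≤-Reasoning

  topRow≥-bound : ∀ v → 1 ≤ v → row≥ c 0 v ≤ n + m' ∸ v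
  topRow≥-bound v 1≤v with row≥ c 0 v in row≡
  ... | zero  = z≤n
  ... | suc l = m+n≤o⇒m≤o∸n (suc l) (begin
      suc l + v                 ≡⟨ +-comm (suc l) v ⟩
      v + suc l                 ≤⟨ +-monoˡ-≤ (suc l) v≤cell ⟩
      cell c 0 l + suc l        ≡⟨ cong (_+ suc l) (sym (+-identityʳ _)) ⟩
      cell c 0 l + 0 + suc l    ≤⟨ cell-bound 0 l (≤-trans 1≤v v≤cell) ⟩
      n + m'                    ∎)
    where
    open ≤-Reasoning
    v≤cell : v ≤ cell c 0 l
    v≤cell = <row≥⇒≤cell 0 l (subst (l <_) (sym row≡) ≤-refl)

countTrue-++ : ∀ xs ys → countTrue (xs ++ ys) ≡ countTrue xs + countTrue ys
countTrue-++ []           ys = refl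
countTrue-++ (true ∷ xs)  ys = cong suc (countTrue-++ xs ys)
countTrue-++ (false ∷ xs) ys = countTrue-++ xs ys

countTrue-[_] : ∀ b → countTrue (b ∷ []) ≡ boolToℕ b
countTrue-[ true  ] = refl
countTrue-[ false ] = refl

countTrue-map-upTo : ∀ P k → countTrue (map P (upTo k)) ≡ count< P k
countTrue-map-upTo P zero    = refl
countTrue-map-upTo P (suc k) = begin
    countTrue (map P (upTo (suc k)))
  ≡⟨ cong (countTrue ∘ map P) (sym (List.upTo-∷ʳ k)) ⟩
    countTrue (map P (upTo k ++ k ∷ []))
  ≡⟨ cong countTrue (List.map-++ P (upTo k) (k ∷ [])) ⟩
    countTrue (map P (upTo k) ++ P k ∷ [])
  ≡⟨ countTrue-++ (map P (upTo k)) (P k ∷ []) ⟩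
    countTrue (map P (upTo k)) + countTrue (P k ∷ [])
  ≡⟨ cong₂ _+_ (countTrue-map-upTo P k) countTrue-[ P k ] ⟩
    count< P (suc k) ∎
  where open ≡-Reasoning

countTrue-map-range1 : ∀ P k → countTrue (map P (range 1 k)) ≡ count< (P ∘ suc) k
countTrue-map-range1 P k =
  trans (cong countTrue (sym (List.map-∘ (upTo k)))) (countTrue-map-upTo (P ∘ suc) k)

sumℤ-++ : ∀ xs ys → sumℤ (xs ++ ys) ≡ sumℤ xs +ℤ sumℤ ys
sumℤ-++ []       ys = sym (ℤ.+-identityˡ _)
sumℤ-++ (x ∷ xs) ys = trans (cong (x +ℤ_) (sumℤ-++ xs ys)) (sym (ℤ.+-assoc x _ _))

sumℤ-map-upTo : ∀ f k → sumℤ (map f (upTo k)) ≡ sumℤ< f k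
sumℤ-map-upTo f zero    = refl
sumℤ-map-upTo f (suc k) = begin
    sumℤ (map f (upTo (suc k)))
  ≡⟨ cong (sumℤ ∘ map f) (sym (List.upTo-∷ʳ k)) ⟩
    sumℤ (map f (upTo k ++ k ∷ []))
  ≡⟨ cong sumℤ (List.map-++ f (upTo k) (k ∷ [])) ⟩
    sumℤ (map f (upTo k) ++ f k ∷ [])
  ≡⟨ sumℤ-++ (map f (upTo k)) (f k ∷ []) ⟩
    sumℤ (map f (upTo k)) +ℤ (f k +ℤ + 0)
  ≡⟨ cong₂ _+ℤ_ (sumℤ-map-upTo f k) (ℤ.+-identityʳ (f k)) ⟩
    sumℤ< f (suc k) ∎
  where open ≡-Reasoning

sumℤ-map-range1 : ∀ f k → sumℤ (map f (range 1 k)) ≡ sumℤ< (f ∘ suc) k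
sumℤ-map-range1 f k = trans (cong sumℤ (sym (List.map-∘ (upTo k)))) (sumℤ-map-upTo (f ∘ suc) k)

range-∷ : ∀ {a b} → a ≤ b → range a b ≡ a ∷ range (suc a) b
range-∷ {a} {b} a≤b rewrite +-∸-assoc 1 a≤b =
  cong₂ _∷_ (+-identityʳ a) (begin
    map (λ t → a + t) (applyUpTo suc (b ∸ a))        ≡⟨ List.map-applyUpTo suc (λ t → a + t) (b ∸ a) ⟩
    applyUpTo (λ t → a + suc t) (b ∸ a)       ≡⟨ applyUpTo-cong (+-suc a) (b ∸ a) ⟩
    applyUpTo (λ t → suc a + t) (b ∸ a)              ≡⟨ sym (List.map-upTo (λ t → suc a + t) (b ∸ a)) ⟩
    map (λ t → suc a + t) (upTo (b ∸ a))             ∎)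
  where
  open ≡-Reasoning
  applyUpTo-cong : ∀ {f g : ℕ → ℕ} → (∀ t → f t ≡ g t) → ∀ k → applyUpTo f k ≡ applyUpTo g k
  applyUpTo-cong f≗g zero    = refl
  applyUpTo-cong f≗g (suc k) = cong₂ _∷_ (f≗g 0) (applyUpTo-cong (f≗g ∘ suc) k)

occurrences : ∀ {n} → ℕ → Array n → ℕ → ℤ
occurrences N c r = sumℤ< (λ k → + row≥ c k r -ℤ + row≥ c k (suc r)) N

-- The top row holds at most N ∸ u entries ≥ u (topRow≥-bound).
topRowFull : ∀ {n} → ℕ → Array n → ℕ → ℕ
topRowFull N c u = boolToℕ ((u <ᵇ N) ∧ (N ∸ u ≤ᵇ row≥ c 0 u))

fullBelow : ∀ {n} → ℕ → Array n → ℕ → ℕ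
fullBelow N c r = sum< (λ u → topRowFull N c (suc u)) (r ∸ 1)

stat : ∀ {n} → ℕ → ℕ → Array n → ℤ
stat N r c = occurrences N c r +ℤ + fullBelow N c r

fullBelow-suc : ∀ {n} N (c : Array n) r → 1 ≤ r → fullBelow N c (suc r) ≡ fullBelow N c r + topRowFull N c r
fullBelow-suc N c (suc r) _ = refl

fullBelow-cong : ∀ {n} N (c′ c : Array n) r → (∀ u → u < r → row≥ c′ 0 u ≡ row≥ c 0 u) →
                 fullBelow N c′ r ≡ fullBelow N c r
fullBelow-cong N c′ c zero    _     = refl
fullBelow-cong N c′ c (suc r) same = sum<-cong r (λ u u<r →
  cong (λ x → boolToℕ ((suc u <ᵇ N) ∧ (N ∸ suc u ≤ᵇ x))) (same (suc u) (s≤s u<r)))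

-- Ū_r equals the statistic

χ-[n-s<n-f] : ∀ n s f → χ (does ((+ n -ℤ + s) ℤ.<? (+ n -ℤ + f))) ≡ + boolToℕ (f <ᵇ s)
χ-[n-s<n-f] n s f with (+ n -ℤ + s) ℤ.<? (+ n -ℤ + f) | f ℕ.<? s
... | yes _ | yes f<s rewrite ≤ᵇ-true f<s = refl
... | no  _ | no  f≮s rewrite ≤ᵇ-false {suc f} (s≤s (≮⇒≥ f≮s)) = refl
... | yes p | no  f≮s = ⊥-elim (ℤ.<⇒≱ p (subst₂ ℤ._≤_ (sym (ℤ.m-n≡m⊖n n f)) (sym (ℤ.m-n≡m⊖n n s))
                                                   (ℤ.⊖-monoʳ-≥-≤ n (≮⇒≥ f≮s))))
... | no ¬p | yes f<s = ⊥-elim (¬p (subst₂ ℤ._<_ (sym (ℤ.m-n≡m⊖n n s)) (sym (ℤ.m-n≡m⊖n n f))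
                                                (ℤ.⊖-monoʳ->-< n f<s)))

<ᵇ-complement : ∀ a b → + boolToℕ (a <ᵇ b) ≡ + 1 -ℤ + boolToℕ (b ≤ᵇ a)
<ᵇ-complement a b with a ℕ.<? b
... | yes a<b rewrite ≤ᵇ-true a<b | ≤ᵇ-false {b} {a} a<b = refl
... | no  a≮b rewrite ≤ᵇ-false {suc a} {b} (s≤s (≮⇒≥ a≮b)) | ≤ᵇ-true (≮⇒≥ a≮b) = refl

module _ {n : ℕ} (m' : ℕ) (c : Array n) where
  private
    N : ℕ
    N = n + m'
    b : ℕ → ℕ → ℤ
    b = bExt n m' c
    cancel : ∀ x y z → (x -ℤ y) -ℤ (x -ℤ z) ≡ z -ℤ y
    cancel = ℤ-Solver.solve-∀

  bExt-inner : ∀ i j → j < N → b (suc i) j ≡ + n -ℤ + row≥ c (N ∸ suc j) (j ∸ i)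
  bExt-inner i j j<N rewrite ≡ᵇ-false j<N | ∸≡suc∸suc j<N =
    cong (λ k → + n -ℤ + k) (countTrue-map-range1 _ n)

  bExt-edge : ∀ i → b (suc i) N ≡ + n -ℤ + suc i
  bExt-edge i rewrite ≡ᵇ-refl N = refl

  bExt-diagonal : ∀ t r → t + r < N → b (suc t) (t + r) ≡ + n -ℤ + row≥ c (N ∸ suc (t + r)) r
  bExt-diagonal t r t+r<N =
    trans (bExt-inner t (t + r) t+r<N) (cong (λ v → + n -ℤ + row≥ c (N ∸ suc (t + r)) v) (m+n∸m≡n t r))

  diagonalStep : ℕ → ℕ → ℤ
  diagonalStep r s = b s (s + r ∸ 1) -ℤ b s (s + r)

  corner : ℕ → ℤ
  corner s = χ (does ((+ n -ℤ + s) ℤ.<? b s (N ∸ 1)))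

  diagonalStep-edge : ∀ r t → suc (t + r) ≡ N → diagonalStep r (suc t) ≡ + suc t -ℤ + row≥ c 0 r
  diagonalStep-edge r t edge = begin
      b (suc t) (t + r) -ℤ b (suc t) (suc (t + r))
    ≡⟨ cong₂ _-ℤ_ (bExt-diagonal t r (≤-reflexive edge)) (trans (cong (b (suc t)) edge) (bExt-edge t)) ⟩
      (+ n -ℤ + row≥ c (N ∸ suc (t + r)) r) -ℤ (+ n -ℤ + suc t)
    ≡⟨ cong (λ i → (+ n -ℤ + row≥ c i r) -ℤ (+ n -ℤ + suc t)) (trans (cong (N ∸_) edge) (n∸n≡0 N)) ⟩
      (+ n -ℤ + row≥ c 0 r) -ℤ (+ n -ℤ + suc t)
    ≡⟨ cancel (+ n) (+ row≥ c 0 r) (+ suc t) ⟩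
      + suc t -ℤ + row≥ c 0 r ∎
    where open ≡-Reasoning

  diagonalStep-inner : ∀ r k t → suc (suc (k + t + r)) ≡ N →
                       diagonalStep r (suc t) ≡ + row≥ c k (suc r) -ℤ + row≥ c (suc k) r
  diagonalStep-inner r k t inner = begin
      b (suc t) (t + r) -ℤ b (suc t) (suc (t + r))
    ≡⟨ cong₂ _-ℤ_ lower upper ⟩
      (+ n -ℤ + row≥ c (suc k) r) -ℤ (+ n -ℤ + row≥ c k (suc r))
    ≡⟨ cancel (+ n) (+ row≥ c (suc k) r) (+ row≥ c k (suc r)) ⟩
      + row≥ c k (suc r) -ℤ + row≥ c (suc k) r ∎
    where
    open ≡-Reasoning
    shape₁ : ∀ k t r → suc k + suc (t + r) ≡ suc (suc (k + t + r))
    shape₁ = ℕ-Solver.solve-∀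
    shape₂ : ∀ k t r → k + suc (t + suc r) ≡ suc (suc (k + t + r))
    shape₂ = ℕ-Solver.solve-∀
    lower : b (suc t) (t + r) ≡ + n -ℤ + row≥ c (suc k) r
    lower = trans (bExt-diagonal t r (≤-trans (m≤n+m _ (suc k)) (≤-reflexive (trans (shape₁ k t r) inner))))
                  (cong (λ i → + n -ℤ + row≥ c i r) (+≡⇒∸≡ (trans (shape₁ k t r) inner)))
    upper : b (suc t) (suc (t + r)) ≡ + n -ℤ + row≥ c k (suc r)
    upper = trans (cong (b (suc t)) (sym (+-suc t r)))
            (trans (bExt-diagonal t (suc r) (≤-trans (m≤n+m _ k) (≤-reflexive (trans (shape₂ k t r) inner))))
                   (cong (λ i → + n -ℤ + row≥ c i (suc r)) (+≡⇒∸≡ (trans (shape₂ k t r) inner))))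

  corner-topRowFull : ∀ u → u < N → corner (N ∸ u) ≡ + 1 -ℤ + topRowFull N c u
  corner-topRowFull u u<N = begin
      corner (N ∸ u)
    ≡⟨ cong (λ x → χ (does ((+ n -ℤ + (N ∸ u)) ℤ.<? x))) topCell ⟩
      χ (does ((+ n -ℤ + (N ∸ u)) ℤ.<? (+ n -ℤ + row≥ c 0 u)))
    ≡⟨ χ-[n-s<n-f] n (N ∸ u) (row≥ c 0 u) ⟩
      + boolToℕ (row≥ c 0 u <ᵇ N ∸ u)
    ≡⟨ <ᵇ-complement (row≥ c 0 u) (N ∸ u) ⟩
      + 1 -ℤ + boolToℕ (N ∸ u ≤ᵇ row≥ c 0 u)
    ≡⟨ cong (λ p → + 1 -ℤ + boolToℕ (p ∧ (N ∸ u ≤ᵇ row≥ c 0 u))) (sym (≤ᵇ-true u<N)) ⟩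
      + 1 -ℤ + topRowFull N c u ∎
    where
    open ≡-Reasoning
    N≡1+[N∸1] : N ≡ suc (N ∸ 1)
    N≡1+[N∸1] = ∸≡suc∸suc (≤-<-trans z≤n u<N)
    topCell : b (N ∸ u) (N ∸ 1) ≡ + n -ℤ + row≥ c 0 u
    topCell = begin
        b (N ∸ u) (N ∸ 1)
      ≡⟨ cong (λ s → b s (N ∸ 1)) (∸≡suc∸suc u<N) ⟩
        b (suc (N ∸ suc u)) (N ∸ 1)
      ≡⟨ bExt-inner (N ∸ suc u) (N ∸ 1) (≤-reflexive (sym N≡1+[N∸1])) ⟩
        + n -ℤ + row≥ c (N ∸ suc (N ∸ 1)) ((N ∸ 1) ∸ (N ∸ suc u))
      ≡⟨ cong₂ (λ i v → + n -ℤ + row≥ c i v)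
               (trans (cong (N ∸_) (sym N≡1+[N∸1])) (n∸n≡0 N))
               (trans (cong ((N ∸ 1) ∸_) (sym (∸-+-assoc N 1 u))) (m∸[m∸n]≡n (∸-monoˡ-≤ 1 u<N))) ⟩
        + n -ℤ + row≥ c 0 u ∎

  corners : ∀ r → 1 ≤ r → r ≤ N →
            sumℤ (map corner (range (suc (N ∸ r)) (N ∸ 1))) ≡ + (r ∸ 1) -ℤ + fullBelow N c r
  corners (suc zero) _ _ =
    cong (λ k → sumℤ (map corner (map (λ t → suc (N ∸ 1) + t) (upTo k)))) (n∸n≡0 (N ∸ 1))
  corners (suc (suc r)) _ r+2≤N = begin
      sumℤ (map corner (range (suc (N ∸ suc (suc r))) (N ∸ 1)))
    ≡⟨ cong (sumℤ ∘ map corner) peel ⟩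
      corner (N ∸ suc r) +ℤ sumℤ (map corner (range (suc (N ∸ suc r)) (N ∸ 1)))
    ≡⟨ cong₂ _+ℤ_ (corner-topRowFull (suc r) r+2≤N) (corners (suc r) (s≤s z≤n) (<⇒≤ r+2≤N)) ⟩
      (+ 1 -ℤ + topRowFull N c (suc r)) +ℤ (+ r -ℤ + fullBelow N c (suc r))
    ≡⟨ regroup (+ topRowFull N c (suc r)) (+ r) (+ fullBelow N c (suc r)) ⟩
      + suc r -ℤ (+ fullBelow N c (suc r) +ℤ + topRowFull N c (suc r))
    ≡⟨ cong (+ suc r -ℤ_) (sym (ℤ.pos-+ (fullBelow N c (suc r)) _)) ⟩
      + suc r -ℤ + fullBelow N c (suc (suc r)) ∎
    where
    open ≡-Reasoning
    regroup : ∀ t r f → (+ 1 -ℤ t) +ℤ (r -ℤ f) ≡ (+ 1 +ℤ r) -ℤ (f +ℤ t)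
    regroup = ℤ-Solver.solve-∀
    first≡ : suc (N ∸ suc (suc r)) ≡ N ∸ suc r
    first≡ = sym (∸≡suc∸suc r+2≤N)
    peel : range (suc (N ∸ suc (suc r))) (N ∸ 1) ≡ (N ∸ suc r) ∷ range (suc (N ∸ suc r)) (N ∸ 1)
    peel = trans (range-∷ (subst (_≤ N ∸ 1) (sym first≡) (∸-monoʳ-≤ N (s≤s z≤n))))
                 (cong₂ (λ x y → x ∷ range y (N ∸ 1)) first≡ (cong suc first≡))

module _ {n m' : ℕ} {c : Array n} (valid : InC n m' c) where
  private
    N : ℕ
    N = n + m'

  sum-row≥-shorten : ∀ v K → 1 ≤ v → K ≤ N → N ≤ K + v → sum< (λ k → row≥ c k v) N ≡ sum< (λ k → row≥ c k v) K
  sum-row≥-shorten v K 1≤v K≤N N≤K+v = sum<-zero-tail _ K≤N (λ k K≤k _ →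
    row≥-vanish valid k v 1≤v (≤-trans N≤K+v (+-monoˡ-≤ v K≤k)))

  occurrences-beyond : ∀ r → 1 ≤ r → N ≤ r → occurrences N c r ≡ + 0
  occurrences-beyond r 1≤r N≤r = trans (sumℤ<-diff _ _ N) (cong₂ (λ x y → + x -ℤ + y)
    (sum-row≥-shorten r 0 1≤r z≤n N≤r) (sum-row≥-shorten (suc r) 0 z<s z≤n (≤-trans N≤r (n≤1+n r))))

  occurrences-split : ∀ r M → 1 ≤ r → suc M + r ≡ N →
    occurrences N c r ≡ (+ row≥ c 0 r +ℤ + sum< (λ k → row≥ c (suc k) r) M) -ℤ + sum< (λ k → row≥ c k (suc r)) M
  occurrences-split r M 1≤r M+r≡N = begin
      occurrences N c r
    ≡⟨ sumℤ<-diff _ _ N ⟩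
      + sum< (λ k → row≥ c k r) N -ℤ + sum< (λ k → row≥ c k (suc r)) N
    ≡⟨ cong₂ (λ x y → + x -ℤ + y) rows≥r rows≥1+r ⟩
      + (row≥ c 0 r + sum< (λ k → row≥ c (suc k) r) M) -ℤ + sum< (λ k → row≥ c k (suc r)) M
    ≡⟨ cong (_-ℤ + sum< (λ k → row≥ c k (suc r)) M) (ℤ.pos-+ (row≥ c 0 r) _) ⟩
      (+ row≥ c 0 r +ℤ + sum< (λ k → row≥ c (suc k) r) M) -ℤ + sum< (λ k → row≥ c k (suc r)) M ∎
    where
    open ≡-Reasoning
    1+M≤N : suc M ≤ N
    1+M≤N = ≤-trans (m≤m+n (suc M) r) (≤-reflexive M+r≡N)
    rows≥r : sum< (λ k → row≥ c k r) N ≡ row≥ c 0 r + sum< (λ k → row≥ c (suc k) r) M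
    rows≥r = trans (sum-row≥-shorten r (suc M) 1≤r 1+M≤N (≤-reflexive (sym M+r≡N))) (sum<-sucˡ _ M)
    rows≥1+r : sum< (λ k → row≥ c k (suc r)) N ≡ sum< (λ k → row≥ c k (suc r)) M
    rows≥1+r = sum-row≥-shorten (suc r) M z<s (≤-trans (n≤1+n M) 1+M≤N)
                                (≤-reflexive (trans (sym M+r≡N) (sym (+-suc M r))))

  diagonalSteps : ∀ r → 1 ≤ r → r ≤ N →
                  sumℤ< (diagonalStep m' c r ∘ suc) (N ∸ r) ≡ + (N ∸ r) -ℤ occurrences N c r
  diagonalSteps r 1≤r r≤N with N ∸ r in M≡N∸r
  ... | zero  = sym (cong (+ 0 -ℤ_) (occurrences-beyond r 1≤r (m∸n≡0⇒m≤n M≡N∸r)))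
  ... | suc M = begin
      sumℤ< (diagonalStep m' c r ∘ suc) (suc M)
    ≡⟨ sumℤ<-reverse (diagonalStep m' c r ∘ suc) (suc M) ⟩
      sumℤ< (λ k → diagonalStep m' c r (suc (suc M ∸ suc k))) (suc M)
    ≡⟨ sumℤ<-sucˡ (λ k → diagonalStep m' c r (suc (suc M ∸ suc k))) M ⟩
      diagonalStep m' c r (suc M) +ℤ sumℤ< (λ k → diagonalStep m' c r (suc (M ∸ suc k))) M
    ≡⟨ cong₂ _+ℤ_ (diagonalStep-edge m' c r M M+r≡N) (sumℤ<-cong M inner) ⟩
      (+ suc M -ℤ + row≥ c 0 r) +ℤ sumℤ< (λ k → + row≥ c k (suc r) -ℤ + row≥ c (suc k) r) M
    ≡⟨ cong ((+ suc M -ℤ + row≥ c 0 r) +ℤ_) (sumℤ<-diff (λ k → row≥ c k (suc r)) (λ k → row≥ c (suc k) r) M) ⟩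
      (+ suc M -ℤ + row≥ c 0 r) +ℤ (+ sum< (λ k → row≥ c k (suc r)) M -ℤ + sum< (λ k → row≥ c (suc k) r) M)
    ≡⟨ regroup (+ suc M) (+ row≥ c 0 r) (+ sum< (λ k → row≥ c k (suc r)) M) (+ sum< (λ k → row≥ c (suc k) r) M) ⟩
      + suc M -ℤ ((+ row≥ c 0 r +ℤ + sum< (λ k → row≥ c (suc k) r) M) -ℤ + sum< (λ k → row≥ c k (suc r)) M)
    ≡⟨ cong (+ suc M -ℤ_) (sym (occurrences-split r M 1≤r M+r≡N)) ⟩
      + suc M -ℤ occurrences N c r ∎
    where
    open ≡-Reasoning
    M+r≡N : suc M + r ≡ N
    M+r≡N = trans (cong (_+ r) (sym M≡N∸r)) (m∸n+n≡m r≤N)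
    inner : ∀ k → k < M → diagonalStep m' c r (suc (M ∸ suc k)) ≡ + row≥ c k (suc r) -ℤ + row≥ c (suc k) r
    inner k k<M = diagonalStep-inner m' c r k (M ∸ suc k) (trans (cong (λ x → suc (x + r)) (m+[n∸m]≡n k<M)) M+r≡N)
    regroup : ∀ m f a s → (m -ℤ f) +ℤ (a -ℤ s) ≡ m -ℤ ((f +ℤ s) -ℤ a)
    regroup = ℤ-Solver.solve-∀

  Ubar≡stat : ∀ r → 1 ≤ r → r ≤ N → Ubar n m' r c ≡ stat N r c
  Ubar≡stat r 1≤r r≤N = begin
      + (N ∸ 1) -ℤ (sumℤ (map (diagonalStep m' c r) (range 1 (N ∸ r))) +ℤ sumℤ (map (corner m' c) (range (suc (N ∸ r)) (N ∸ 1))))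
    ≡⟨ cong₂ (λ x y → + (N ∸ 1) -ℤ (x +ℤ y))
             (trans (sumℤ-map-range1 (diagonalStep m' c r) (N ∸ r)) (diagonalSteps r 1≤r r≤N)) (corners m' c r 1≤r r≤N) ⟩
      + (N ∸ 1) -ℤ ((+ (N ∸ r) -ℤ occurrences N c r) +ℤ (+ (r ∸ 1) -ℤ + fullBelow N c r))
    ≡⟨ cong (λ x → x -ℤ ((+ (N ∸ r) -ℤ occurrences N c r) +ℤ (+ (r ∸ 1) -ℤ + fullBelow N c r)))
            (trans (cong +_ (N∸1≡ r 1≤r r≤N)) (ℤ.pos-+ (N ∸ r) (r ∸ 1))) ⟩
      (+ (N ∸ r) +ℤ + (r ∸ 1)) -ℤ ((+ (N ∸ r) -ℤ occurrences N c r) +ℤ (+ (r ∸ 1) -ℤ + fullBelow N c r))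
    ≡⟨ cancel₂ (+ (N ∸ r)) (+ (r ∸ 1)) (occurrences N c r) (+ fullBelow N c r) ⟩
      stat N r c ∎
    where
    open ≡-Reasoning
    cancel₂ : ∀ a b e d → (a +ℤ b) -ℤ ((a -ℤ e) +ℤ (b -ℤ d)) ≡ e +ℤ d
    cancel₂ = ℤ-Solver.solve-∀
    N∸1≡ : ∀ r → 1 ≤ r → r ≤ N → N ∸ 1 ≡ N ∸ r + (r ∸ 1)
    N∸1≡ (suc r) _ r<N = sym (trans (cong (_+ r) (sym (∸-+-assoc N 1 r))) (m∸n+n≡m (∸-monoˡ-≤ 1 r<N)))

mapColumn : (ℕ → ℕ → ℕ) → ℕ → List ℕ → List ℕ
mapColumn f i []       = []
mapColumn f i (x ∷ xs) = f i x ∷ mapColumn f (suc i) xs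

mapColumns : ∀ {k} → (ℕ → List ℕ → List ℕ) → ℕ → Vec (List ℕ) k → Vec (List ℕ) k
mapColumns f l Vec.[]         = Vec.[]
mapColumns f l (xs Vec.∷ xss) = f l xs Vec.∷ mapColumns f (suc l) xss

mapCells : ∀ {n} → (ℕ → ℕ → ℕ → ℕ) → Array n → Array n
mapCells g = mapColumns (λ l → mapColumn (λ i → g i l) 0) 0

length-mapColumn : ∀ f i xs → length (mapColumn f i xs) ≡ length xs
length-mapColumn f i []       = refl
length-mapColumn f i (x ∷ xs) = cong suc (length-mapColumn f (suc i) xs)

at-mapColumn : ∀ f i xs k → k < length xs → at (mapColumn f i xs) k ≡ f (i + k) (at xs k)
at-mapColumn f i (x ∷ xs) zero    _         = cong (λ j → f j x) (sym (+-identityʳ i))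
at-mapColumn f i (x ∷ xs) (suc k) (s≤s k<len) =
  trans (at-mapColumn f (suc i) xs k k<len) (cong (λ j → f j (at xs k)) (sym (+-suc i k)))

mapColumn-inverse : ∀ f h i xs → (∀ k → k < length xs → h (i + k) (f (i + k) (at xs k)) ≡ at xs k) →
                    mapColumn h i (mapColumn f i xs) ≡ xs
mapColumn-inverse f h i []       _   = refl
mapColumn-inverse f h i (x ∷ xs) inv = cong₂ _∷_
  (trans (cong (λ j → h j (f j x)) (sym (+-identityʳ i))) (inv 0 z<s))
  (mapColumn-inverse f h (suc i) xs (λ k k<len →
     trans (cong (λ j → h j (f j (at xs k))) (sym (+-suc i k))) (inv (suc k) (s≤s k<len))))

column-mapColumns : ∀ {k} f l (xss : Vec (List ℕ) k) j → f (l + j) [] ≡ [] →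
                    column (toList (mapColumns f l xss)) j ≡ f (l + j) (column (toList xss) j)
column-mapColumns f l Vec.[]         j       f[]≡[] = sym f[]≡[]
column-mapColumns f l (xs Vec.∷ xss) zero    _      = cong (λ i → f i xs) (sym (+-identityʳ l))
column-mapColumns f l (xs Vec.∷ xss) (suc j) f[]≡[] =
  trans (column-mapColumns f (suc l) xss j (subst (λ i → f i [] ≡ []) (+-suc l j) f[]≡[]))
        (cong (λ i → f i (column (toList xss) j)) (sym (+-suc l j)))

mapColumns-inverse : ∀ {k} f h l (xss : Vec (List ℕ) k) →
  (∀ j → j < k → h (l + j) (f (l + j) (column (toList xss) j)) ≡ column (toList xss) j) →
  mapColumns h l (mapColumns f l xss) ≡ xss
mapColumns-inverse f h l Vec.[]         _   = refl
mapColumns-inverse f h l (xs Vec.∷ xss) inv = cong₂ Vec._∷_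
  (trans (cong (λ i → h i (f i xs)) (sym (+-identityʳ l))) (inv 0 z<s))
  (mapColumns-inverse f h (suc l) xss (λ j j<k →
     trans (cong (λ i → h i (f i (column (toList xss) j))) (sym (+-suc l j))) (inv (suc j) (s≤s j<k))))

module _ {n : ℕ} (g : ℕ → ℕ → ℕ → ℕ) (c : Array n) where

  column-mapCells : ∀ l → column (toList (mapCells g c)) l ≡ mapColumn (λ i → g i l) 0 (column (toList c) l)
  column-mapCells l = column-mapColumns _ 0 c l refl

  length-mapCells : ∀ l → length (column (toList (mapCells g c)) l) ≡ length (column (toList c) l)
  length-mapCells l = trans (cong length (column-mapCells l)) (length-mapColumn (λ i → g i l) 0 (column (toList c) l))

  cell-mapCells : ∀ i l → (cell c i l ≡ 0 → g i l 0 ≡ 0) → cell (mapCells g c) i l ≡ g i l (cell c i l)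
  cell-mapCells i l g0≡0 with i ℕ.<? length (column (toList c) l)
  ... | yes i<len = trans (cong (λ xs → at xs i) (column-mapCells l)) (at-mapColumn (λ i → g i l) 0 (column (toList c) l) i i<len)
  ... | no  i≮len = begin
      cell (mapCells g c) i l  ≡⟨ at-beyond (column (toList (mapCells g c)) l)
                                            (≤-trans (≤-reflexive (length-mapCells l)) (≮⇒≥ i≮len)) ⟩
      0                        ≡⟨ sym (g0≡0 empty) ⟩
      g i l 0                  ≡⟨ cong (g i l) (sym empty) ⟩
      g i l (cell c i l)       ∎
    where
    open ≡-Reasoning
    empty : cell c i l ≡ 0
    empty = at-beyond (column (toList c) l) (≮⇒≥ i≮len)

  mapCells-inverse : ∀ h → (∀ i l → h i l (g i l (cell c i l)) ≡ cell c i l) → mapCells h (mapCells g c) ≡ c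
  mapCells-inverse h inv = mapColumns-inverse _ _ 0 c (λ l _ →
    mapColumn-inverse (λ i → g i l) (λ i → h i l) 0 (column (toList c) l) (λ i _ → inv i l))

  allColsEven-mapCells : allColsEven (mapCells g c) ≡ allColsEven c
  allColsEven-mapCells = go 0 c
    where
    go : ∀ {k} l (xss : Vec (List ℕ) k) →
         allColsEven (mapColumns (λ l → mapColumn (λ i → g i l) 0) l xss) ≡ allColsEven xss
    go l Vec.[]         = refl
    go l (xs Vec.∷ xss) = cong₂ (λ len rest → isEven len ∧ rest) (length-mapColumn (λ i → g i l) 0 xs) (go (suc l) xss)

-- The Bender–Knuth involution exchanging the values r and r + 1

-- The entries of row i in the window [lo i, hi i) are r or r + 1 and are
-- constrained neither by the rows i − 1 and i + 1 nor by the column bound;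
-- in each window the numbers of r's and of (r + 1)'s are exchanged.
module BenderKnuth {n : ℕ} (m' r : ℕ) (c : Array n) where

  a μ b : ℕ → ℕ
  a i = row≥ c i (suc (suc r))
  μ i = row≥ c i (suc r)
  b i = row≥ c i r

  lo hi ν : ℕ → ℕ
  lo i       = a i ⊔ b (suc i)
  hi zero    = b 0 ⊓ (n + m' ∸ suc r)
  hi (suc i) = b (suc i) ⊓ a i
  ν i        = lo i + hi i ∸ μ i

  inWindow : ℕ → ℕ → Bool
  inWindow i l = (lo i ≤ᵇ l) ∧ (l <ᵇ hi i)

  swapped : ℕ → ℕ → ℕ
  swapped i l = if l <ᵇ ν i then suc r else r

  bkCell : ℕ → ℕ → ℕ → ℕ
  bkCell i l x = if inWindow i l then swapped i l else x

  bk : Array n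
  bk = mapCells bkCell c

  data WindowView (i l : ℕ) : Set where
    inside  : lo i ≤ l → l < hi i → inWindow i l ≡ true → WindowView i l
    outside : l < lo i ⊎ hi i ≤ l → inWindow i l ≡ false → WindowView i l

  windowView : ∀ i l → WindowView i l
  windowView i l with lo i ℕ.≤? l | l ℕ.<? hi i
  ... | yes lo≤l | yes l<hi = inside lo≤l l<hi (cong₂ _∧_ (≤ᵇ-true lo≤l) (≤ᵇ-true l<hi))
  ... | yes lo≤l | no  l≮hi = outside (inj₂ (≮⇒≥ l≮hi))
    (trans (cong ((lo i ≤ᵇ l) ∧_) (≤ᵇ-false {suc l} (≰⇒> l≮hi))) (∧-zeroʳ (lo i ≤ᵇ l)))
  ... | no  lo≰l | _        = outside (inj₁ (≰⇒> lo≰l)) (cong (_∧ (l <ᵇ hi i)) (≤ᵇ-false (≰⇒> lo≰l)))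

  data SwappedView (i l : ℕ) : Set where
    raised : l < ν i → swapped i l ≡ suc r → SwappedView i l
    kept   : ν i ≤ l → swapped i l ≡ r → SwappedView i l

  swappedView : ∀ i l → SwappedView i l
  swappedView i l with l ℕ.<? ν i
  ... | yes l<ν = raised l<ν (cong (if_then suc r else r) (≤ᵇ-true l<ν))
  ... | no  l≮ν = kept (≮⇒≥ l≮ν) (cong (if_then suc r else r) (≤ᵇ-false {suc l} (≰⇒> l≮ν)))

  r≤swapped : ∀ i l → r ≤ swapped i l
  r≤swapped i l with swappedView i l
  ... | raised _ eq = subst (r ≤_) (sym eq) (n≤1+n r)
  ... | kept   _ eq = subst (r ≤_) (sym eq) ≤-refl

  swapped≤1+r : ∀ i l → swapped i l ≤ suc r
  swapped≤1+r i l with swappedView i l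
  ... | raised _ eq = subst (_≤ suc r) (sym eq) ≤-refl
  ... | kept   _ eq = subst (_≤ suc r) (sym eq) (n≤1+n r)

  hi≤b : ∀ i → hi i ≤ b i
  hi≤b zero    = m⊓n≤m (b 0) _
  hi≤b (suc i) = m⊓n≤m (b (suc i)) _

  b≤lo : ∀ i → b (suc i) ≤ lo i
  b≤lo i = m≤n⊔m (a i) (b (suc i))

  hi≤a : ∀ i → hi (suc i) ≤ a i
  hi≤a i = m⊓n≤n (b (suc i)) (a i)

  swapped-mono : ∀ i l → swapped i (suc l) ≤ swapped i l
  swapped-mono i l with swappedView i (suc l) | swappedView i l
  ... | raised _ eq₁ | raised _ eq₀ rewrite eq₁ | eq₀ = ≤-refl
  ... | raised 1+l<ν _ | kept ν≤l _ = ⊥-elim (<⇒≱ (<-trans (n<1+n l) 1+l<ν) ν≤l)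
  ... | kept _ eq₁   | _ rewrite eq₁ = r≤swapped i l

module _ {n m' r : ℕ} {c : Array n} (valid : InC n m' c) where
  open BenderKnuth m' r c

  cell-fromWindow : ∀ i l → lo i ≤ l → cell c i l ≤ suc r
  cell-fromWindow i l lo≤l = s≤s⁻¹ (row≥≤⇒cell< valid i l z<s (≤-trans (m≤m⊔n (a i) (b (suc i))) lo≤l))

  cell-beforeWindowEnd : ∀ i l → l < hi i → r ≤ cell c i l
  cell-beforeWindowEnd i l l<hi = <row≥⇒≤cell valid i l (<-≤-trans l<hi (hi≤b i))


  cell-inWindow : ∀ i l → lo i ≤ l → l < hi i → cell c i l ≡ (if l <ᵇ μ i then suc r else r)
  cell-inWindow i l lo≤l l<hi with l ℕ.<? μ i
  ... | yes l<μ rewrite ≤ᵇ-true l<μ =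
    ≤-antisym (cell-fromWindow i l lo≤l) (<row≥⇒≤cell valid i l l<μ)
  ... | no  l≮μ rewrite ≤ᵇ-false {suc l} (≰⇒> l≮μ) =
    ≤-antisym (s≤s⁻¹ (row≥≤⇒cell< valid i l z<s (≮⇒≥ l≮μ))) (cell-beforeWindowEnd i l l<hi)


module _ {n m' r : ℕ} {c : Array n} (valid : InC n m' c) (1≤r : 1 ≤ r) where
  open BenderKnuth m' r c

  cell-beforeWindow : ∀ i l → l < lo i → suc r ≤ cell c i l
  cell-beforeWindow i l l<lo with <⊔⇒<⊎< {l} {a i} {b (suc i)} l<lo
  ... | inj₁ l<a = ≤-trans (n≤1+n (suc r)) (<row≥⇒≤cell valid i l l<a)
  ... | inj₂ l<b = ≤-trans (s≤s r≤below) (decreasing valid l i (≤-trans 1≤r r≤below))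
    where r≤below : r ≤ cell c (suc i) l
          r≤below = <row≥⇒≤cell valid (suc i) l l<b

  cell-afterWindow : ∀ i l → hi i ≤ l → cell c i l ≤ r
  cell-afterWindow zero l hi≤l with ⊓≤⇒≤⊎≤ {l} {b 0} hi≤l
  ... | inj₁ b≤l  = <⇒≤ (row≥≤⇒cell< valid 0 l 1≤r b≤l)
  ... | inj₂ N∸r≤l = ≤-trans (bounded valid l 0) (∸-swap-≤ {n + m'} N∸r≤l)
  cell-afterWindow (suc i) l hi≤l with ⊓≤⇒≤⊎≤ {l} {b (suc i)} hi≤l
  ... | inj₁ b≤l = <⇒≤ (row≥≤⇒cell< valid (suc i) l 1≤r b≤l)
  ... | inj₂ a≤l with cell c (suc i) l ℕ.≟ 0
  ...   | yes cell≡0 = subst (_≤ r) (sym cell≡0) z≤n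
  ...   | no  cell≢0 = s≤s⁻¹ (≤-trans (decreasing valid l i (n≢0⇒n>0 cell≢0))
                                      (s≤s⁻¹ (row≥≤⇒cell< valid i l z<s a≤l)))

  lo≤μ : ∀ i → lo i ≤ μ i
  lo≤μ i = ≮⇒≥ (λ μ<lo → <-irrefl refl (≤cell⇒<row≥ valid i (μ i) z<s (cell-beforeWindow i (μ i) μ<lo)))

  μ≤hi : ∀ i → μ i ≤ hi i
  μ≤hi i = ≮⇒≥ (λ hi<μ → <⇒≱ (<row≥⇒≤cell valid i (hi i) hi<μ) (cell-afterWindow i (hi i) ≤-refl))

  ν≤hi : ∀ i → ν i ≤ hi i
  ν≤hi i = m≤n+o⇒m∸n≤o (lo i + hi i) (μ i) (+-monoˡ-≤ (hi i) (lo≤μ i))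

  lo≤ν : ∀ i → lo i ≤ ν i
  lo≤ν i = m+n≤o⇒m≤o∸n (lo i) (+-monoʳ-≤ (lo i) (μ≤hi i))

  ν+μ≡lo+hi : ∀ i → ν i + μ i ≡ lo i + hi i
  ν+μ≡lo+hi i = m∸n+n≡m (≤-trans (μ≤hi i) (m≤n+m (hi i) (lo i)))

  cell-bk : ∀ i l → cell bk i l ≡ bkCell i l (cell c i l)
  cell-bk i l = cell-mapCells bkCell c i l keepsZero
    where
    keepsZero : cell c i l ≡ 0 → bkCell i l 0 ≡ 0
    keepsZero cell≡0 with windowView i l
    ... | inside _ l<hi _   = ⊥-elim (<⇒≱ 1≤r (subst (r ≤_) cell≡0 (cell-beforeWindowEnd valid i l l<hi)))
    ... | outside _ out≡ff  = cong (if_then swapped i l else 0) out≡ff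

  cell-bk-inside : ∀ {i l} → inWindow i l ≡ true → cell bk i l ≡ swapped i l
  cell-bk-inside {i} {l} in≡tt = trans (cell-bk i l) (cong (if_then swapped i l else cell c i l) in≡tt)

  cell-bk-outside : ∀ {i l} → inWindow i l ≡ false → cell bk i l ≡ cell c i l
  cell-bk-outside {i} {l} out≡ff = trans (cell-bk i l) (cong (if_then swapped i l else cell c i l) out≡ff)

  bk-positive : ∀ l → Positive (column (toList bk) l)
  bk-positive l i i<len with windowView i l
  ... | inside _ _ in≡tt   = subst (1 ≤_) (sym (cell-bk-inside in≡tt)) (≤-trans 1≤r (r≤swapped i l))
  ... | outside _ out≡ff   = subst (1 ≤_) (sym (cell-bk-outside out≡ff))
                                   (positive valid l i (subst (i <_) (length-mapCells bkCell c l) i<len))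

  bk-decreasing : ∀ l → StrictlyDecreasing (column (toList bk) l)
  bk-decreasing l i 1≤below with windowView (suc i) l | windowView i l
  ... | inside _ l<hi₁ _ | inside lo≤l _ _ =
    ⊥-elim (<⇒≱ l<hi₁ (≤-trans (hi≤b (suc i)) (≤-trans (b≤lo i) lo≤l)))
  ... | inside _ l<hi₁ in₁ | outside _ out₀ rewrite cell-bk-inside in₁ | cell-bk-outside out₀ =
    <-≤-trans (s≤s (swapped≤1+r (suc i) l)) (<row≥⇒≤cell valid i l (<-≤-trans l<hi₁ (hi≤a i)))
  ... | outside _ out₁ | inside lo≤l _ in₀ rewrite cell-bk-outside out₁ | cell-bk-inside in₀ =
    <-≤-trans (row≥≤⇒cell< valid (suc i) l 1≤r (≤-trans (b≤lo i) lo≤l)) (r≤swapped i l)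
  ... | outside _ out₁ | outside _ out₀ rewrite cell-bk-outside out₁ | cell-bk-outside out₀ =
    decreasing valid l i 1≤below

  bk-bounded : ∀ l i → cell bk i l ≤ n + m' ∸ suc l
  bk-bounded l i with windowView i l
  ... | outside _ out≡ff = subst (_≤ n + m' ∸ suc l) (sym (cell-bk-outside out≡ff)) (bounded valid l i)
  ... | inside _ l<hi in≡tt with swappedView i l
  ...   | kept _ sw≡r = subst (_≤ n + m' ∸ suc l) (sym (trans (cell-bk-inside in≡tt) sw≡r))
                              (≤-trans (cell-beforeWindowEnd valid i l l<hi) (bounded valid l i))
  ...   | raised l<ν sw≡1+r = subst (_≤ n + m' ∸ suc l) (sym (trans (cell-bk-inside in≡tt) sw≡1+r))
                                    (room i (<-≤-trans l<ν (ν≤hi i)))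
    where
    room : ∀ i → l < hi i → suc r ≤ n + m' ∸ suc l
    room zero    l<hi = ∸-swap-< {n + m'} (<-≤-trans l<hi (m⊓n≤n (b 0) _))
    room (suc i) l<hi = ≤-trans (n≤1+n (suc r))
      (≤-trans (<row≥⇒≤cell valid i l (<-≤-trans l<hi (hi≤a i))) (bounded valid l i))

  bk-rowsDecrease : ∀ l i → cell bk i (suc l) ≤ cell bk i l
  bk-rowsDecrease l i with windowView i (suc l) | windowView i l
  ... | inside _ _ in₁ | inside _ _ in₀ rewrite cell-bk-inside in₁ | cell-bk-inside in₀ = swapped-mono i l
  ... | inside _ _ in₁ | outside (inj₁ l<lo) out₀ rewrite cell-bk-inside in₁ | cell-bk-outside out₀ =
    ≤-trans (swapped≤1+r i (suc l)) (cell-beforeWindow i l l<lo)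
  ... | inside _ 1+l<hi _ | outside (inj₂ hi≤l) _ = ⊥-elim (<⇒≱ (<-trans (n<1+n l) 1+l<hi) hi≤l)
  ... | outside (inj₁ 1+l<lo) _ | inside lo≤l _ _ = ⊥-elim (<⇒≱ (<-trans (n<1+n l) 1+l<lo) lo≤l)
  ... | outside (inj₂ hi≤1+l) out₁ | inside _ _ in₀ rewrite cell-bk-outside out₁ | cell-bk-inside in₀ =
    ≤-trans (cell-afterWindow i (suc l) hi≤1+l) (r≤swapped i l)
  ... | outside _ out₁ | outside _ out₀ rewrite cell-bk-outside out₁ | cell-bk-outside out₀ =
    rowsDecrease valid l i

  bk-valid : InC n m' bk
  bk-valid = record
    { positive = bk-positive ; decreasing = bk-decreasing ; bounded = bk-bounded ; rowsDecrease = bk-rowsDecrease }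

  row≥-bk-outer : ∀ v → v ≤ r ⊎ suc (suc r) ≤ v → ∀ i → row≥ bk i v ≡ row≥ c i v
  row≥-bk-outer v v∉ i = count<-cong n (λ l _ → sameSide v∉ l)
    where
    sameSide : v ≤ r ⊎ suc (suc r) ≤ v → ∀ l → (v ≤ᵇ cell bk i l) ≡ (v ≤ᵇ cell c i l)
    sameSide v∉′ l with windowView i l
    ... | outside _ out≡ff = cong (v ≤ᵇ_) (cell-bk-outside out≡ff)
    ... | inside lo≤l l<hi in≡tt with v∉′
    ...   | inj₁ v≤r   rewrite cell-bk-inside in≡tt =
      trans (≤ᵇ-true (≤-trans v≤r (r≤swapped i l))) (sym (≤ᵇ-true (≤-trans v≤r (cell-beforeWindowEnd valid i l l<hi))))
    ...   | inj₂ r+2≤v rewrite cell-bk-inside in≡tt =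
      trans (≤ᵇ-false (<-≤-trans (s≤s (swapped≤1+r i l)) r+2≤v))
            (sym (≤ᵇ-false (<-≤-trans (s≤s (cell-fromWindow valid i l lo≤l)) r+2≤v)))

  row≥-bk-middle : ∀ i → row≥ bk i (suc r) ≡ ν i
  row≥-bk-middle i = count<-initial _ n (≤-trans (ν≤hi i) (≤-trans (hi≤b i) (count<-≤ _ n))) (λ l _ → raisedBelowν l)
    where
    raisedBelowν : ∀ l → (suc r ≤ᵇ cell bk i l) ≡ (l <ᵇ ν i)
    raisedBelowν l with windowView i l | swappedView i l
    ... | inside _ _ in≡tt | raised l<ν sw≡1+r rewrite cell-bk-inside in≡tt | sw≡1+r =
      trans (≤ᵇ-true {suc r} ≤-refl) (sym (≤ᵇ-true l<ν))
    ... | inside _ _ in≡tt | kept ν≤l sw≡r rewrite cell-bk-inside in≡tt | sw≡r =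
      trans (≤ᵇ-false {suc r} ≤-refl) (sym (≤ᵇ-false {suc l} (s≤s ν≤l)))
    ... | outside (inj₁ l<lo) out≡ff | _ rewrite cell-bk-outside out≡ff =
      trans (≤ᵇ-true (cell-beforeWindow i l l<lo)) (sym (≤ᵇ-true (<-≤-trans l<lo (lo≤ν i))))
    ... | outside (inj₂ hi≤l) out≡ff | _ rewrite cell-bk-outside out≡ff =
      trans (≤ᵇ-false (s≤s (cell-afterWindow i l hi≤l))) (sym (≤ᵇ-false {suc l} (s≤s (≤-trans (ν≤hi i) hi≤l))))

module _ {n m' r : ℕ} {c : Array n} (valid : InC n m' c) (1≤r : 1 ≤ r) where
  open BenderKnuth m' r c
  private
    N : ℕ
    N = n + m'
    module BK′ = BenderKnuth m' r bk

  a′≡a : ∀ i → BK′.a i ≡ a i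
  a′≡a = row≥-bk-outer valid 1≤r (suc (suc r)) (inj₂ ≤-refl)

  b′≡b : ∀ i → BK′.b i ≡ b i
  b′≡b = row≥-bk-outer valid 1≤r r (inj₁ ≤-refl)

  lo′≡lo : ∀ i → BK′.lo i ≡ lo i
  lo′≡lo i = cong₂ _⊔_ (a′≡a i) (b′≡b (suc i))

  hi′≡hi : ∀ i → BK′.hi i ≡ hi i
  hi′≡hi zero    = cong (_⊓ (N ∸ suc r)) (b′≡b 0)
  hi′≡hi (suc i) = cong₂ _⊓_ (b′≡b (suc i)) (a′≡a i)

  ν′≡μ : ∀ i → BK′.ν i ≡ μ i
  ν′≡μ i = begin
      BK′.lo i + BK′.hi i ∸ BK′.μ i   ≡⟨ cong₂ _∸_ (cong₂ _+_ (lo′≡lo i) (hi′≡hi i)) (row≥-bk-middle valid 1≤r i) ⟩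
      lo i + hi i ∸ ν i               ≡⟨ m∸[m∸n]≡n (≤-trans (μ≤hi valid 1≤r i) (m≤n+m (hi i) (lo i))) ⟩
      μ i                             ∎
    where open ≡-Reasoning

  inWindow′≡inWindow : ∀ i l → BK′.inWindow i l ≡ inWindow i l
  inWindow′≡inWindow i l = cong₂ (λ x y → (x ≤ᵇ l) ∧ (l <ᵇ y)) (lo′≡lo i) (hi′≡hi i)

  bkCell-involutive : ∀ i l → BK′.bkCell i l (bkCell i l (cell c i l)) ≡ cell c i l
  bkCell-involutive i l with windowView i l
  ... | outside _ out≡ff = begin
      BK′.bkCell i l (bkCell i l (cell c i l))  ≡⟨ cong (BK′.bkCell i l) (cong (if_then swapped i l else cell c i l) out≡ff) ⟩
      BK′.bkCell i l (cell c i l)               ≡⟨ cong (if_then BK′.swapped i l else cell c i l)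
                                                      (trans (inWindow′≡inWindow i l) out≡ff) ⟩
      cell c i l                                ∎
    where open ≡-Reasoning
  ... | inside lo≤l l<hi in≡tt = begin
      BK′.bkCell i l (bkCell i l (cell c i l))  ≡⟨ cong (BK′.bkCell i l) (cong (if_then swapped i l else cell c i l) in≡tt) ⟩
      BK′.bkCell i l (swapped i l)              ≡⟨ cong (if_then BK′.swapped i l else swapped i l)
                                                      (trans (inWindow′≡inWindow i l) in≡tt) ⟩
      BK′.swapped i l                           ≡⟨ cong (λ p → if l <ᵇ p then suc r else r) (ν′≡μ i) ⟩
      (if l <ᵇ μ i then suc r else r)           ≡⟨ sym (cell-inWindow valid i l lo≤l l<hi) ⟩
      cell c i l                                ∎
    where open ≡-Reasoning

  bk-involutive : BK′.bk ≡ c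
  bk-involutive = mapCells-inverse bkCell c BK′.bkCell bkCell-involutive

  window₀-end : hi 0 + topRowFull N c r ≡ b 0
  window₀-end with r ℕ.<? N
  ... | no r≮N rewrite ≤ᵇ-false {suc r} {N} (s≤s (≮⇒≥ r≮N)) =
    trans (+-identityʳ _) (trans (cong (_⊓ (N ∸ suc r)) b0≡0) (sym b0≡0))
    where b0≡0 : b 0 ≡ 0
          b0≡0 = n≤0⇒n≡0 (subst (b 0 ≤_) (m≤n⇒m∸n≡0 (≮⇒≥ r≮N)) (topRow≥-bound valid r 1≤r))
  ... | yes r<N rewrite ≤ᵇ-true r<N with N ∸ r ℕ.≤? b 0
  ...   | yes full rewrite ≤ᵇ-true full = begin
      b 0 ⊓ (N ∸ suc r) + 1        ≡⟨ cong (λ x → x ⊓ (N ∸ suc r) + 1) b0≡ ⟩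
      suc (N ∸ suc r) ⊓ (N ∸ suc r) + 1 ≡⟨ cong (_+ 1) (m≥n⇒m⊓n≡n (n≤1+n _)) ⟩
      N ∸ suc r + 1                ≡⟨ +-comm (N ∸ suc r) 1 ⟩
      suc (N ∸ suc r)              ≡⟨ sym b0≡ ⟩
      b 0                          ∎
    where
    open ≡-Reasoning
    b0≡ : b 0 ≡ suc (N ∸ suc r)
    b0≡ = trans (≤-antisym (topRow≥-bound valid r 1≤r) full) (∸≡suc∸suc r<N)
  ...   | no notFull rewrite ≤ᵇ-false (≰⇒> notFull) =
    trans (+-identityʳ _) (m≤n⇒m⊓n≡m (s≤s⁻¹ (subst (b 0 <_) (∸≡suc∸suc r<N) (≰⇒> notFull))))

  b-bottom : b N ≡ 0
  b-bottom = row≥-vanish valid N r 1≤r (m≤m+n N r)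

  windows-total : sum< (λ k → lo k + hi k) N + topRowFull N c r ≡ sum< a N + sum< b N
  windows-total = begin
      sum< (λ k → lo k + hi k) N + full
    ≡⟨ cong (_+ full) (sum<-+ lo hi N) ⟩
      sum< lo N + sum< hi N + full
    ≡⟨ cong (λ x → sum< lo N + x + full) hi-shift ⟩
      sum< lo N + (hi 0 + sum< (hi ∘ suc) N) + full
    ≡⟨ regroup (sum< lo N) (hi 0) (sum< (hi ∘ suc) N) full ⟩
      (sum< lo N + sum< (hi ∘ suc) N) + (hi 0 + full)
    ≡⟨ cong₂ _+_ interleave window₀-end ⟩
      (sum< a N + sum< (b ∘ suc) N) + b 0
    ≡⟨ regroup′ (sum< a N) (sum< (b ∘ suc) N) (b 0) ⟩
      sum< a N + (b 0 + sum< (b ∘ suc) N)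
    ≡⟨ cong (_+_ (sum< a N)) b-shift ⟩
      sum< a N + sum< b N ∎
    where
    open ≡-Reasoning
    full : ℕ
    full = topRowFull N c r
    regroup : ∀ x h y f → x + (h + y) + f ≡ (x + y) + (h + f)
    regroup = ℕ-Solver.solve-∀
    regroup′ : ∀ x y b → (x + y) + b ≡ x + (b + y)
    regroup′ = ℕ-Solver.solve-∀
    hi-bottom : hi N ≡ 0
    hi-bottom = n≤0⇒n≡0 (subst (hi N ≤_) b-bottom (hi≤b N))
    hi-shift : sum< hi N ≡ hi 0 + sum< (hi ∘ suc) N
    hi-shift = trans (sym (trans (cong (_+_ (sum< hi N)) hi-bottom) (+-identityʳ _))) (sum<-sucˡ hi N)
    b-shift : b 0 + sum< (b ∘ suc) N ≡ sum< b N
    b-shift = trans (sym (sum<-sucˡ b N)) (trans (cong (_+_ (sum< b N)) b-bottom) (+-identityʳ _))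
    interleave : sum< lo N + sum< (hi ∘ suc) N ≡ sum< a N + sum< (b ∘ suc) N
    interleave = trans (sym (sum<-+ lo (hi ∘ suc) N))
                 (trans (sum<-cong N (λ k _ → m⊔n+n⊓m≡m+n (a k) (b (suc k)))) (sum<-+ a (b ∘ suc) N))

  occurrences-bk : occurrences N bk (suc r) ≡ + sum< ν N -ℤ + sum< a N
  occurrences-bk = trans (sumℤ<-cong N (λ k _ → cong₂ (λ x y → + x -ℤ + y) (row≥-bk-middle valid 1≤r k) (a′≡a k)))
                         (sumℤ<-diff ν a N)

  fullBelow-bk : fullBelow N bk (suc r) ≡ fullBelow N c r + topRowFull N c r
  fullBelow-bk = trans (fullBelow-suc N bk r 1≤r)
    (cong₂ _+_ (fullBelow-cong N bk c r (λ u u<r → row≥-bk-outer valid 1≤r u (inj₁ (<⇒≤ u<r)) 0))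
               (cong (λ x → boolToℕ ((r <ᵇ N) ∧ (N ∸ r ≤ᵇ x))) (b′≡b 0)))

  windows-balance : sum< ν N + sum< μ N + topRowFull N c r ≡ sum< a N + sum< b N
  windows-balance = trans (cong (_+ topRowFull N c r)
    (trans (sym (sum<-+ ν μ N)) (sum<-cong N (λ k _ → ν+μ≡lo+hi valid 1≤r k)))) windows-total

  stat-bk : stat N (suc r) bk ≡ stat N r c
  stat-bk = begin
      occurrences N bk (suc r) +ℤ + fullBelow N bk (suc r)
    ≡⟨ cong₂ (λ x y → x +ℤ + y) occurrences-bk fullBelow-bk ⟩
      (+ sum< ν N -ℤ + sum< a N) +ℤ + (fullBelow N c r + topRowFull N c r)
    ≡⟨ diff-exchange {sum< ν N} {sum< μ N} {sum< a N} {sum< b N} (fullBelow N c r) windows-balance ⟩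
      (+ sum< b N -ℤ + sum< μ N) +ℤ + fullBelow N c r
    ≡⟨ cong (_+ℤ + fullBelow N c r) (sym (sumℤ<-diff b μ N)) ⟩
      occurrences N c r +ℤ + fullBelow N c r ∎
    where open ≡-Reasoning

-- Lifting: add one to every entry and close every odd column with a 1

evenᵇ : ℕ → Bool
evenᵇ zero          = true
evenᵇ (suc zero)    = false
evenᵇ (suc (suc k)) = evenᵇ k

isEven≡evenᵇ : ∀ k → isEven k ≡ evenᵇ k
isEven≡evenᵇ zero          = refl
isEven≡evenᵇ (suc zero)    = refl
isEven≡evenᵇ (suc (suc k)) =
  trans (cong (λ x → x % 2 ≡ᵇ 0) (+-comm 2 k)) (trans (cong (_≡ᵇ 0) ([m+n]%n≡m%n k 2)) (isEven≡evenᵇ k))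

evenᵇ-suc : ∀ k → evenᵇ (suc k) ≡ not (evenᵇ k)
evenᵇ-suc zero          = refl
evenᵇ-suc (suc zero)    = refl
evenᵇ-suc (suc (suc k)) = evenᵇ-suc k

closing : Bool → List ℕ
closing true  = []
closing false = 1 ∷ []

liftWith : Bool → List ℕ → List ℕ
liftWith even xs = map suc xs ++ closing even

liftColumn : List ℕ → List ℕ
liftColumn xs = liftWith (evenᵇ (length xs)) xs

dropFinalOne : List ℕ → List ℕ
dropFinalOne []          = []
dropFinalOne (x ∷ [])    = if x ≡ᵇ 1 then [] else x ∷ []
dropFinalOne (x ∷ y ∷ t) = x ∷ dropFinalOne (y ∷ t)

lowerColumn : List ℕ → List ℕ
lowerColumn ys = map pred (dropFinalOne ys)

at-All : ∀ {P : ℕ → Set} xs i → All P xs → i < length xs → P (at xs i)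
at-All (x ∷ xs) zero    (px ∷ _)   _           = px
at-All (x ∷ xs) (suc i) (_ ∷ pxs) (s≤s i<len) = at-All xs i pxs i<len

Positive⇒All : ∀ xs → Positive xs → All (1 ≤_) xs
Positive⇒All []       _   = []
Positive⇒All (x ∷ xs) pos = pos 0 z<s ∷ Positive⇒All xs (λ i i<len → pos (suc i) (s≤s i<len))

length-liftWith : ∀ e xs → length (liftWith e xs) ≡ length xs + boolToℕ (not e)
length-liftWith e xs = trans (List.length-++ (map suc xs)) (cong₂ _+_ (List.length-map suc xs) (length-closing e))
  where length-closing : ∀ e → length (closing e) ≡ boolToℕ (not e)
        length-closing true  = refl
        length-closing false = refl

evenᵇ-length-liftColumn : ∀ xs → evenᵇ (length (liftColumn xs)) ≡ true
evenᵇ-length-liftColumn xs with evenᵇ (length xs) in even≡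
... | true  = trans (cong evenᵇ (trans (length-liftWith true xs) (+-identityʳ _))) even≡
... | false = trans (cong evenᵇ (trans (length-liftWith false xs) (+-comm (length xs) 1)))
                    (trans (evenᵇ-suc (length xs)) (cong not even≡))

at-liftWith-< : ∀ e xs k → k < length xs → at (liftWith e xs) k ≡ suc (at xs k)
at-liftWith-< e (x ∷ xs) zero    _           = refl
at-liftWith-< e (x ∷ xs) (suc k) (s≤s k<len) = at-liftWith-< e xs k k<len

at-liftWith-≥ : ∀ e xs k → length xs ≤ k → at (liftWith e xs) k ≤ 1
at-liftWith-≥ true  []       k       _           = z≤n
at-liftWith-≥ false []       zero    _           = ≤-refl
at-liftWith-≥ false []       (suc k) _           = z≤n
at-liftWith-≥ e     (x ∷ xs) (suc k) (s≤s len≤k) = at-liftWith-≥ e xs k len≤k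

All-liftWith : ∀ e xs → All (1 ≤_) (liftWith e xs)
All-liftWith true  []       = []
All-liftWith false []       = z<s ∷ []
All-liftWith e     (x ∷ xs) = z<s ∷ All-liftWith e xs

strictDecPos-liftWith : ∀ e xs → T (strictDecPos xs) → T (strictDecPos (liftWith e xs))
strictDecPos-liftWith true  []          _ = tt
strictDecPos-liftWith false []          _ = tt
strictDecPos-liftWith true  (x ∷ [])    _ = tt
strictDecPos-liftWith false (x ∷ [])    h = T-∧⁺ {2 ≤ᵇ suc x} (<⇒<ᵇ (s≤s (≤ᵇ⇒≤ 1 x h))) tt
strictDecPos-liftWith e     (x ∷ y ∷ t) h =
  T-∧⁺ {suc y <ᵇ suc x} (proj₁ (T-∧⁻ {y <ᵇ x} h)) (strictDecPos-liftWith e (y ∷ t) (proj₂ (T-∧⁻ {y <ᵇ x} h)))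

allLe-liftWith : ∀ e b xs → T (allLe b xs) → T (allLe (suc b) (liftWith e xs))
allLe-liftWith true  b []       _ = tt
allLe-liftWith false b []       _ = T-∧⁺ {1 ≤ᵇ suc b} tt tt
allLe-liftWith e     b (x ∷ xs) h =
  T-∧⁺ {suc x ≤ᵇ suc b} (≤⇒≤ᵇ (s≤s (≤ᵇ⇒≤ x b (proj₁ (T-∧⁻ {x ≤ᵇ b} h)))))
       (allLe-liftWith e b xs (proj₂ (T-∧⁻ {x ≤ᵇ b} h)))

-- The closing 1 of the right column needs a cell of the left column next to it.
dominates-liftWith : ∀ e₁ e₂ xs ys → T (dominates xs ys) →
                     (e₂ ≡ false → length ys < length xs ⊎ e₁ ≡ false) →
                     T (dominates (liftWith e₁ xs) (liftWith e₂ ys))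
dominates-liftWith e₁ true  xs       []       _ _     = tt
dominates-liftWith e₁ false (x ∷ xs) []       _ _     = T-∧⁺ {1 ≤ᵇ suc x} tt tt
dominates-liftWith e₁ false []       []       _ room with room refl
... | inj₂ refl = T-∧⁺ {1 ≤ᵇ 1} tt tt
dominates-liftWith e₁ e₂    (x ∷ xs) (y ∷ ys) h room =
  T-∧⁺ {suc y ≤ᵇ suc x} (≤⇒≤ᵇ (s≤s (≤ᵇ⇒≤ y x (proj₁ (T-∧⁻ {y ≤ᵇ x} h)))))
       (dominates-liftWith e₁ e₂ xs ys (proj₂ (T-∧⁻ {y ≤ᵇ x} h))
          (λ e₂≡ff → Sum.map₁ s≤s⁻¹ (room e₂≡ff)))

dropFinalOne-∷ʳ1 : ∀ zs → dropFinalOne (zs ++ 1 ∷ []) ≡ zs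
dropFinalOne-∷ʳ1 []           = refl
dropFinalOne-∷ʳ1 (z ∷ [])     = refl
dropFinalOne-∷ʳ1 (z ∷ z′ ∷ t) = cong (z ∷_) (dropFinalOne-∷ʳ1 (z′ ∷ t))

dropFinalOne-≥2 : ∀ zs → All (2 ≤_) zs → dropFinalOne zs ≡ zs
dropFinalOne-≥2 []           _                     = refl
dropFinalOne-≥2 (z ∷ [])     (s≤s (s≤s _) ∷ _)     = refl
dropFinalOne-≥2 (z ∷ z′ ∷ t) (_ ∷ all₂)            = cong (z ∷_) (dropFinalOne-≥2 (z′ ∷ t) all₂)

map-pred-suc : ∀ xs → map pred (map suc xs) ≡ xs
map-pred-suc xs = trans (sym (List.map-∘ xs)) (List.map-id xs)

map-suc-pred : ∀ xs → All (1 ≤_) xs → map suc (map pred xs) ≡ xs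
map-suc-pred xs all₁ = trans (sym (List.map-∘ xs)) (List.map-id-local (All.map suc∘pred all₁))
  where suc∘pred : ∀ {x} → 1 ≤ x → suc (pred x) ≡ x
        suc∘pred (s≤s _) = refl

lower-liftColumn : ∀ xs → Positive xs → lowerColumn (liftColumn xs) ≡ xs
lower-liftColumn xs pos with evenᵇ (length xs)
... | true  = trans (cong (map pred) (trans (cong dropFinalOne (List.++-identityʳ (map suc xs)))
                                            (dropFinalOne-≥2 (map suc xs) (All.map⁺ (All.map s≤s (Positive⇒All xs pos))))))
                    (map-pred-suc xs)
... | false = trans (cong (map pred) (dropFinalOne-∷ʳ1 (map suc xs))) (map-pred-suc xs)

data FinalOneView (ys : List ℕ) : Set where
  noFinalOne : All (2 ≤_) ys → FinalOneView ys
  finalOne   : ∀ zs → All (2 ≤_) zs → ys ≡ zs ++ 1 ∷ [] → FinalOneView ys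

finalOneView : ∀ ys → Positive ys → StrictlyDecreasing ys → FinalOneView ys
finalOneView []       _   _   = noFinalOne []
finalOneView (y ∷ ys) pos dec with finalOneView ys (λ i i<len → pos (suc i) (s≤s i<len)) (λ i → dec (suc i))
... | finalOne zs all₂ refl = finalOne (y ∷ zs) (≤-trans (s≤s 1≤next) (dec 0 1≤next) ∷ all₂) refl
  where 1≤next : 1 ≤ at (zs ++ 1 ∷ []) 0
        1≤next = pos 1 (s≤s (subst (0 <_) (sym (List.length-++ zs)) (≤-trans z<s (m≤n+m 1 (length zs)))))
... | noFinalOne [] with y | pos 0 z<s
...   | suc zero     | _ = finalOne [] [] refl
...   | suc (suc _)  | _ = noFinalOne (s≤s (s≤s z≤n) ∷ [])
finalOneView (y ∷ (y′ ∷ ys)) pos dec | noFinalOne (2≤y′ ∷ all₂) =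
  noFinalOne (≤-trans (s≤s (≤-trans (n≤1+n 1) 2≤y′)) (dec 0 (≤-trans (n≤1+n 1) 2≤y′)) ∷ 2≤y′ ∷ all₂)

lift-lowerColumn : ∀ ys → Positive ys → StrictlyDecreasing ys → evenᵇ (length ys) ≡ true →
                   liftColumn (lowerColumn ys) ≡ ys
lift-lowerColumn ys pos dec even with finalOneView ys pos dec
... | noFinalOne all₂ rewrite dropFinalOne-≥2 ys all₂ | List.length-map pred ys | even =
  trans (List.++-identityʳ _) (map-suc-pred ys (All.map (≤-trans (n≤1+n 1)) all₂))
... | finalOne zs all₂ refl rewrite dropFinalOne-∷ʳ1 zs | List.length-map pred zs with evenᵇ (length zs) in even≡
...   | false = cong (_++ 1 ∷ []) (map-suc-pred zs (All.map (≤-trans (n≤1+n 1)) all₂))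
...   | true  = ⊥-elim (true≢false (begin
      true                                ≡⟨ sym even ⟩
      evenᵇ (length (zs ++ 1 ∷ []))       ≡⟨ cong evenᵇ (trans (List.length-++ zs) (+-comm (length zs) 1)) ⟩
      evenᵇ (suc (length zs))             ≡⟨ evenᵇ-suc (length zs) ⟩
      not (evenᵇ (length zs))             ≡⟨ cong not even≡ ⟩
      false                               ∎))
  where
  open ≡-Reasoning
  true≢false : true ≡ false → ⊥
  true≢false ()

at-lowerColumn : ∀ ys i → at (lowerColumn ys) i ≡ at ys i ∸ 1
at-lowerColumn ys i = trans (at-map-pred (dropFinalOne ys) i) (at-dropFinalOne ys i)
  where
  at-map-pred : ∀ zs i → at (map pred zs) i ≡ at zs i ∸ 1
  at-map-pred []           i       = refl
  at-map-pred (zero ∷ zs)  zero    = refl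
  at-map-pred (suc z ∷ zs) zero    = refl
  at-map-pred (z ∷ zs)     (suc i) = at-map-pred zs i
  at-dropFinalOne : ∀ ys i → at (dropFinalOne ys) i ∸ 1 ≡ at ys i ∸ 1
  at-dropFinalOne []          i       = refl
  at-dropFinalOne (x ∷ [])    zero    with x ≡ᵇ 1 in x≡1
  ... | true  = sym (cong (_∸ 1) (≡ᵇ⇒≡ x 1 (subst T (sym x≡1) tt)))
  ... | false = refl
  at-dropFinalOne (x ∷ [])    (suc i) with x ≡ᵇ 1
  ... | true  = refl
  ... | false = refl
  at-dropFinalOne (x ∷ y ∷ t) zero    = refl
  at-dropFinalOne (x ∷ y ∷ t) (suc i) = at-dropFinalOne (y ∷ t) i

All-lowerColumn : ∀ ys → Positive ys → StrictlyDecreasing ys → All (1 ≤_) (lowerColumn ys)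
All-lowerColumn ys pos dec with finalOneView ys pos dec
... | noFinalOne all₂ rewrite dropFinalOne-≥2 ys all₂ = All.map⁺ (All.map pred-mono-≤ all₂)
... | finalOne zs all₂ refl rewrite dropFinalOne-∷ʳ1 zs = All.map⁺ (All.map pred-mono-≤ all₂)

lift : ∀ {n} → Array n → Array n
lift = Vec.map liftColumn

lower : ∀ {n} → Array n → Array n
lower = Vec.map lowerColumn

column-map : ∀ {k} (f : List ℕ → List ℕ) (xss : Vec (List ℕ) k) l → f [] ≡ [] →
             column (toList (Vec.map f xss)) l ≡ f (column (toList xss) l)
column-map f xss l f[]≡[] = trans (cong (λ cs → column cs l) (Vec.toList-map f xss)) (go (toList xss) l)
  where
  go : ∀ cs l → column (map f cs) l ≡ f (column cs l)
  go []       l       = sym f[]≡[]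
  go (x ∷ cs) zero    = refl
  go (x ∷ cs) (suc l) = go cs l

map-inverse : ∀ {k} (f g : List ℕ → List ℕ) (xss : Vec (List ℕ) k) →
              (∀ l → l < k → g (f (column (toList xss) l)) ≡ column (toList xss) l) →
              Vec.map g (Vec.map f xss) ≡ xss
map-inverse f g Vec.[]         _   = refl
map-inverse f g (xs Vec.∷ xss) inv = cong₂ Vec._∷_ (inv 0 z<s) (map-inverse f g xss (λ l l<k → inv (suc l) (s≤s l<k)))

length-column-mono : ∀ {N j cs} → ValidColumns N j cs → ∀ l → length (column cs (suc l)) ≤ length (column cs l)
length-column-mono {cs = cs} valid l = ≮⇒≥ (λ longer →
  <⇒≱ (positive valid (suc l) (length (column cs l)) longer)
      (subst (at (column cs (suc l)) (length (column cs l)) ≤_) (at-beyond (column cs l) ≤-refl) (rowsDecrease valid l _)))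

allColsEven⇒evenᵇ : ∀ {n} (c : Array n) → T (allColsEven c) → ∀ l → evenᵇ (length (column (toList c) l)) ≡ true
allColsEven⇒evenᵇ c = go (toList c)
  where
  go : ∀ cs → T (List.foldr (λ col acc → isEven (length col) ∧ acc) true cs) → ∀ l → evenᵇ (length (column cs l)) ≡ true
  go []       _    l       = refl
  go (x ∷ cs) even zero    = trans (sym (isEven≡evenᵇ (length x))) (Equivalence.to T-≡ (proj₁ (T-∧⁻ {isEven (length x)} even)))
  go (x ∷ cs) even (suc l) = go cs (proj₂ (T-∧⁻ {isEven (length x)} even)) l

lift-allColsEven : ∀ {n} (c : Array n) → T (allColsEven (lift c))
lift-allColsEven c rewrite Vec.toList-map liftColumn c = go (toList c)
  where
  go : ∀ cs → T (List.foldr (λ col acc → isEven (length col) ∧ acc) true (map liftColumn cs))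
  go []       = tt
  go (x ∷ cs) rewrite isEven≡evenᵇ (length (liftColumn x)) | evenᵇ-length-liftColumn x = go cs

column-lift : ∀ {n} (c : Array n) l → column (toList (lift c)) l ≡ liftColumn (column (toList c) l)
column-lift c l = column-map liftColumn c l refl

column-lower : ∀ {n} (c : Array n) l → column (toList (lower c)) l ≡ lowerColumn (column (toList c) l)
column-lower c l = column-map lowerColumn c l refl

lift-positive : ∀ {n} (c : Array n) l → Positive (column (toList (lift c)) l)
lift-positive c l i i<len rewrite column-lift c l =
  at-All (liftColumn (column (toList c) l)) i (All-liftWith _ (column (toList c) l)) i<len

module _ {n m : ℕ} {c : Array n} (valid : InC n m c) where
  private
    xs : ℕ → List ℕ
    xs = column (toList c)

  lift-decreasing : ∀ l → StrictlyDecreasing (column (toList (lift c)) l)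
  lift-decreasing l rewrite column-lift c l = strictDecPos-decreasing (liftColumn (xs l))
    (strictDecPos-liftWith _ (xs l) (strictDecPos-complete (xs l) (positive valid l) (decreasing valid l)))

  lift-bounded : ∀ l i → at (column (toList (lift c)) l) i ≤ n + suc m ∸ suc l
  lift-bounded l i rewrite column-lift c l with xs l in xs≡
  ... | []      = z≤n
  ... | x ∷ xs′ = subst (at (liftColumn (x ∷ xs′)) i ≤_) bound≡
      (allLe-sound _ (liftColumn (x ∷ xs′)) (allLe-liftWith _ _ (x ∷ xs′) (allLe-complete _ (x ∷ xs′) bounded′)) i)
    where
    bounded′ : ∀ i → at (x ∷ xs′) i ≤ n + m ∸ suc l
    bounded′ i = subst (λ ys → at ys i ≤ n + m ∸ suc l) xs≡ (bounded valid l i)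
    1≤x : 1 ≤ x
    1≤x = subst (λ ys → 1 ≤ at ys 0) xs≡ (positive valid l 0 (subst (λ ys → 0 < length ys) (sym xs≡) z<s))
    bound≡ : suc (n + m ∸ suc l) ≡ n + suc m ∸ suc l
    bound≡ = sym (trans (cong (_∸ suc l) (+-suc n m))
                        (∸≡suc∸suc {n + m} {l} (<⇒≤ (m∸n>0⇒n<m {n + m} {suc l} (≤-trans 1≤x (bounded′ 0))))))

  lift-rowsDecrease : ∀ l i → at (column (toList (lift c)) (suc l)) i ≤ at (column (toList (lift c)) l) i
  lift-rowsDecrease l i rewrite column-lift c l | column-lift c (suc l) =
    dominates-sound (liftColumn (xs l)) (liftColumn (xs (suc l)))
      (dominates-liftWith _ _ (xs l) (xs (suc l)) (dominates-complete (xs l) (xs (suc l)) (positive valid (suc l)) (rowsDecrease valid l))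
                          room) i
    where
    room : evenᵇ (length (xs (suc l))) ≡ false → length (xs (suc l)) < length (xs l) ⊎ evenᵇ (length (xs l)) ≡ false
    room odd with m≤n⇒m<n∨m≡n (length-column-mono valid l)
    ... | inj₁ shorter  = inj₁ shorter
    ... | inj₂ sameLen = inj₂ (trans (cong evenᵇ (sym sameLen)) odd)

  lift-valid : InC n (suc m) (lift c)
  lift-valid = record
    { positive = lift-positive c ; decreasing = lift-decreasing ; bounded = lift-bounded ; rowsDecrease = lift-rowsDecrease }

  lower-lift : lower (lift c) ≡ c
  lower-lift = map-inverse liftColumn lowerColumn c (λ l _ → lower-liftColumn (xs l) (positive valid l))

module _ {n m : ℕ} {c : Array n} (valid : InC n (suc m) c) where
  private
    ys : ℕ → List ℕ
    ys = column (toList c)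

  lower-positive : ∀ l → Positive (column (toList (lower c)) l)
  lower-positive l i i<len rewrite column-lower c l =
    at-All (lowerColumn (ys l)) i (All-lowerColumn (ys l) (positive valid l) (decreasing valid l)) i<len

  lower-decreasing : ∀ l → StrictlyDecreasing (column (toList (lower c)) l)
  lower-decreasing l i 1≤below rewrite column-lower c l | at-lowerColumn (ys l) (suc i) | at-lowerColumn (ys l) i =
    ∸-monoˡ-< (decreasing valid l i (≤-trans (n≤1+n 1) 2≤below)) (≤-trans (n≤1+n 1) 2≤below)
    where
    2≤below : 2 ≤ at (ys l) (suc i)
    2≤below = ≤-trans (+-monoˡ-≤ 1 1≤below) (≤-reflexive (m∸n+n≡m (≤-trans z<s (≤-trans 1≤below (m∸n≤m _ 1)))))

  lower-bounded : ∀ l i → at (column (toList (lower c)) l) i ≤ n + m ∸ suc l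
  lower-bounded l i rewrite column-lower c l | at-lowerColumn (ys l) i =
    subst (at (ys l) i ∸ 1 ≤_) bound≡ (∸-monoˡ-≤ 1 (bounded valid l i))
    where
    bound≡ : n + suc m ∸ suc l ∸ 1 ≡ n + m ∸ suc l
    bound≡ = trans (cong (λ k → k ∸ suc l ∸ 1) (+-suc n m))
                   (trans (∸-+-assoc (n + m) l 1) (cong (n + m ∸_) (+-comm l 1)))

  lower-rowsDecrease : ∀ l i → at (column (toList (lower c)) (suc l)) i ≤ at (column (toList (lower c)) l) i
  lower-rowsDecrease l i rewrite column-lower c l | column-lower c (suc l) | at-lowerColumn (ys l) i | at-lowerColumn (ys (suc l)) i =
    ∸-monoˡ-≤ 1 (rowsDecrease valid l i)

  lower-valid : InC n m (lower c)
  lower-valid = record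
    { positive = lower-positive ; decreasing = lower-decreasing ; bounded = lower-bounded ; rowsDecrease = lower-rowsDecrease }

  lift-lower : T (allColsEven c) → lift (lower c) ≡ c
  lift-lower even = map-inverse lowerColumn liftColumn c (λ l _ →
    lift-lowerColumn (ys l) (positive valid l) (decreasing valid l) (allColsEven⇒evenᵇ c even l))

countTrue-toList : ∀ {k} (xss : Vec (List ℕ) k) (P : List ℕ → Bool) →
                   countTrue (map P (toList xss)) ≡ count< (λ l → P (column (toList xss) l)) k
countTrue-toList Vec.[]                 P = refl
countTrue-toList {suc k} (xs Vec.∷ xss) P = begin
    countTrue (P xs ∷ map P (toList xss))
  ≡⟨ countTrue-++ (P xs ∷ []) (map P (toList xss)) ⟩
    countTrue (P xs ∷ []) + countTrue (map P (toList xss))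
  ≡⟨ cong₂ _+_ countTrue-[ P xs ] (countTrue-toList xss P) ⟩
    boolToℕ (P xs) + count< (λ l → P (column (toList xss) l)) k
  ≡⟨ sym (sum<-sucˡ (λ l → boolToℕ (P (column (toList (xs Vec.∷ xss)) l))) k) ⟩
    count< (λ l → P (column (toList (xs Vec.∷ xss)) l)) (suc k) ∎
  where open ≡-Reasoning

length-column≤ : ∀ {n m'} {c : Array n} → InC n m' c → ∀ l → length (column (toList c) l) ≤ n + m'
length-column≤ {n} {m'} {c} valid l with length (column (toList c) l) in len≡
... | zero  = z≤n
... | suc k = begin
    suc k                        ≤⟨ +-monoˡ-≤ k 1≤cell ⟩
    cell c k l + k               ≤⟨ m≤m+n _ (suc l) ⟩
    cell c k l + k + suc l       ≤⟨ cell-bound valid k l 1≤cell ⟩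
    n + m'                       ∎
  where
  open ≤-Reasoning
  1≤cell : 1 ≤ cell c k l
  1≤cell = positive valid l k (subst (k <_) (sym len≡) ≤-refl)

cell-lift : ∀ {n} (c : Array n) k l → cell (lift c) k l ≡ at (liftColumn (column (toList c) l)) k
cell-lift c k l = cong (λ ys → at ys k) (column-lift c l)

sum-row≥-lift : ∀ {n} (c : Array n) v K → sum< (λ k → row≥ (lift c) k v) K ≡
                sum< (λ l → count< (λ k → v ≤ᵇ at (liftColumn (column (toList c) l)) k) K) n
sum-row≥-lift {n} c v K = trans (sum<-swap (λ k l → boolToℕ (v ≤ᵇ cell (lift c) k l)) K n)
  (sum<-cong n (λ l _ → sum<-cong K (λ k _ → cong (λ x → boolToℕ (v ≤ᵇ x)) (cell-lift c k l))))

topRow≥-lift : ∀ {n} (c : Array n) u → 1 ≤ u → row≥ (lift c) 0 (suc u) ≡ row≥ c 0 u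
topRow≥-lift {n} c (suc u) _ =
  count<-cong n (λ l _ → trans (cong (suc (suc u) ≤ᵇ_) (cell-lift c 0 l)) (shifted (column (toList c) l)))
  where
  shifted : ∀ ys → (suc (suc u) ≤ᵇ at (liftColumn ys) 0) ≡ (suc u ≤ᵇ at ys 0)
  shifted []      = refl
  shifted (_ ∷ _) = refl

topRowFull-lift : ∀ {n} m (c : Array n) u → 1 ≤ u → topRowFull (n + suc m) (lift c) (suc u) ≡ topRowFull (n + m) c u
topRowFull-lift {n} m c u 1≤u = trans (cong (λ M → topRowFull M (lift c) (suc u)) (+-suc n m))
  (cong (λ x → boolToℕ ((u <ᵇ n + m) ∧ (n + m ∸ u ≤ᵇ x))) (topRow≥-lift c u 1≤u))

module _ {n m : ℕ} {c : Array n} (valid : InC n m c) where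
  private
    N N′ : ℕ
    N  = n + m
    N′ = n + suc m
    xs : ℕ → List ℕ
    xs = column (toList c)

  length-liftColumn≤ : ∀ l → length (liftColumn (xs l)) ≤ N′
  length-liftColumn≤ l = subst (λ ys → length ys ≤ N′) (column-lift c l) (length-column≤ (lift-valid valid) l)

  count≥1-liftColumn : ∀ l → count< (λ k → 1 ≤ᵇ at (liftColumn (xs l)) k) N′ ≡ length (liftColumn (xs l))
  count≥1-liftColumn l = count<-initial _ N′ (length-liftColumn≤ l) (λ k _ → occupied k)
    where
    ys : List ℕ
    ys = liftColumn (xs l)
    occupied : ∀ k → (1 ≤ᵇ at ys k) ≡ (k <ᵇ length ys)
    occupied k with k ℕ.<? length ys
    ... | yes k<len = trans (≤ᵇ-true (at-All ys k (All-liftWith _ (xs l)) k<len)) (sym (≤ᵇ-true k<len))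
    ... | no  k≮len = trans (≤ᵇ-false (subst (_< 1) (sym (at-beyond ys (≮⇒≥ k≮len))) z<s))
                            (sym (≤ᵇ-false {suc k} (s≤s (≮⇒≥ k≮len))))

  count≥2-liftColumn : ∀ l → count< (λ k → 2 ≤ᵇ at (liftColumn (xs l)) k) N′ ≡ length (xs l)
  count≥2-liftColumn l = count<-initial _ N′
    (≤-trans (≤-trans (m≤m+n _ _) (≤-reflexive (sym (length-liftWith _ (xs l))))) (length-liftColumn≤ l))
    (λ k _ → lifted k)
    where
    lifted : ∀ k → (2 ≤ᵇ at (liftColumn (xs l)) k) ≡ (k <ᵇ length (xs l))
    lifted k with k ℕ.<? length (xs l)
    ... | yes k<len = trans (≤ᵇ-true (subst (2 ≤_) (sym (at-liftWith-< _ (xs l) k k<len)) (s≤s (positive valid l k k<len))))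
                            (sym (≤ᵇ-true k<len))
    ... | no  k≮len = trans (≤ᵇ-false (s≤s (at-liftWith-≥ _ (xs l) k (≮⇒≥ k≮len))))
                            (sym (≤ᵇ-false {suc k} (s≤s (≮⇒≥ k≮len))))

  -- The 1's of lift c are the closing 1's of the odd columns of c.
  stat-lift-1 : stat N′ 1 (lift c) ≡ + VC c
  stat-lift-1 = begin
      occurrences N′ (lift c) 1 +ℤ + 0
    ≡⟨ cong (_+ℤ + 0) (sumℤ<-diff (λ k → row≥ (lift c) k 1) (λ k → row≥ (lift c) k 2) N′) ⟩
      + sum< (λ k → row≥ (lift c) k 1) N′ -ℤ + sum< (λ k → row≥ (lift c) k 2) N′ +ℤ + 0
    ≡⟨ cong₂ (λ x y → + x -ℤ + y +ℤ + 0)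
             (trans (sum-row≥-lift c 1 N′) (sum<-cong n (λ l _ → trans (count≥1-liftColumn l) (length-liftWith _ (xs l)))))
             (trans (sum-row≥-lift c 2 N′) (sum<-cong n (λ l _ → count≥2-liftColumn l))) ⟩
      + sum< (λ l → length (xs l) + odd l) n -ℤ + Σlen +ℤ + 0
    ≡⟨ cong (λ x → + x -ℤ + Σlen +ℤ + 0) (sum<-+ (λ l → length (xs l)) odd n) ⟩
      + (Σlen + sum< odd n) -ℤ + Σlen +ℤ + 0
    ≡⟨ cong (λ x → x -ℤ + Σlen +ℤ + 0) (ℤ.pos-+ Σlen (sum< odd n)) ⟩
      (+ Σlen +ℤ + sum< odd n) -ℤ + Σlen +ℤ + 0
    ≡⟨ cancel (+ Σlen) (+ sum< odd n) ⟩
      + sum< odd n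
    ≡⟨ cong +_ (sym (trans (countTrue-toList c _)
                           (sum<-cong n (λ l _ → cong (boolToℕ ∘ not) (isEven≡evenᵇ (length (xs l))))))) ⟩
      + VC c ∎
    where
    open ≡-Reasoning
    odd : ℕ → ℕ
    odd l = boolToℕ (not (evenᵇ (length (xs l))))
    Σlen : ℕ
    Σlen = sum< (λ l → length (xs l)) n
    cancel : ∀ a b → (a +ℤ b) -ℤ a +ℤ + 0 ≡ b
    cancel = ℤ-Solver.solve-∀

  topRow≥1-lift< : 1 ≤ n → row≥ (lift c) 0 1 < N
  topRow≥1-lift< 1≤n = ≰⇒> (λ N≤row → lastColumn-empty N≤row (xs last) refl)
    where
    last : ℕ
    last = n ∸ 1
    1+last≡n : suc last ≡ n
    1+last≡n = trans (+-comm 1 last) (m∸n+n≡m 1≤n)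
    lastColumn-empty : N ≤ row≥ (lift c) 0 1 → ∀ ys → xs last ≡ ys → ⊥
    lastColumn-empty N≤row ys xs≡ys = no-room ys xs≡ys
      where
      occupied : 1 ≤ at (liftColumn (xs last)) 0
      occupied = subst (1 ≤_) (cell-lift c 0 last)
        (<row≥⇒≤cell (lift-valid valid) 0 last (≤-trans (≤-reflexive 1+last≡n) (≤-trans (m≤m+n n m) N≤row)))
      no-room : ∀ ys → xs last ≡ ys → ⊥
      no-room []      xs≡[] = <⇒≱ occupied (≤-reflexive (cong (λ zs → at (liftColumn zs) 0) xs≡[]))
      no-room (y ∷ _) xs≡y∷ = <⇒≱ 1≤y (subst (y ≤_) (trans (cong (N ∸_) 1+last≡n) (m≤n⇒m∸n≡0 N≤n)) y≤bound)
        where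
        N≤n : N ≤ n
        N≤n = ≤-trans N≤row (count<-≤ _ n)
        1≤y : 1 ≤ y
        1≤y = subst (λ zs → 1 ≤ at zs 0) xs≡y∷ (positive valid last 0 (subst (λ zs → 0 < length zs) (sym xs≡y∷) z<s))
        y≤bound : y ≤ N ∸ suc last
        y≤bound = subst (λ zs → at zs 0 ≤ N ∸ suc last) xs≡y∷ (bounded valid last 0)

  topRowFull-lift-1 : 1 ≤ n → topRowFull N′ (lift c) 1 ≡ 0
  topRowFull-lift-1 1≤n = begin
      topRowFull N′ (lift c) 1
    ≡⟨ cong (λ M → topRowFull M (lift c) 1) (+-suc n m) ⟩
      boolToℕ ((0 <ᵇ N) ∧ (N ≤ᵇ row≥ (lift c) 0 1))
    ≡⟨ cong (λ x → boolToℕ ((0 <ᵇ N) ∧ x)) (≤ᵇ-false (topRow≥1-lift< 1≤n)) ⟩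
      boolToℕ ((0 <ᵇ N) ∧ false)
    ≡⟨ cong boolToℕ (∧-zeroʳ (0 <ᵇ N)) ⟩
      0 ∎
    where open ≡-Reasoning

  fullBelow-lift : 1 ≤ n → fullBelow N′ (lift c) (suc N) ≡ fullBelow N c N
  fullBelow-lift 1≤n = begin
      sum< g N                          ≡⟨ cong (sum< g) (∸≡suc∸suc {N} {0} (≤-trans 1≤n (m≤m+n n m))) ⟩
      sum< g (suc (N ∸ 1))              ≡⟨ sum<-sucˡ g (N ∸ 1) ⟩
      g 0 + sum< (g ∘ suc) (N ∸ 1)      ≡⟨ cong₂ _+_ (topRowFull-lift-1 1≤n)
                                                     (sum<-cong (N ∸ 1) (λ u _ → topRowFull-lift m c (suc u) z<s)) ⟩
      fullBelow N c N                   ∎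
    where
    open ≡-Reasoning
    g : ℕ → ℕ
    g u = topRowFull N′ (lift c) (suc u)

  stat-lift-top : 1 ≤ n → stat N′ (suc N) (lift c) ≡ stat N N c
  stat-lift-top 1≤n = cong₂ (λ x y → x +ℤ + y)
    (trans (occurrences-beyond (lift-valid valid) (suc N) z<s (≤-reflexive (+-suc n m)))
           (sym (occurrences-beyond valid N (≤-trans 1≤n (m≤m+n n m)) ≤-refl)))
    (fullBelow-lift 1≤n)

record StatIso (A B : Set) (f : A → ℤ) (g : B → ℤ) : Set where
  field
    to        : A → B
    from      : B → A
    from∘to   : ∀ a → from (to a) ≡ a
    to∘from   : ∀ b → to (from b) ≡ b
    preserves : ∀ a → g (to a) ≡ f a
open StatIso

StatIso-refl : ∀ {A f g} → (∀ a → g a ≡ f a) → StatIso A A f g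
StatIso-refl g≗f = record
  { to = λ a → a ; from = λ a → a ; from∘to = λ _ → refl ; to∘from = λ _ → refl ; preserves = g≗f }

infixr 5 _⟫_
infix  6 _⁻¹

_⁻¹ : ∀ {A B f g} → StatIso A B f g → StatIso B A g f
_⁻¹ {g = g} φ = record
  { to = from φ ; from = to φ ; from∘to = to∘from φ ; to∘from = from∘to φ
  ; preserves = λ b → trans (sym (preserves φ (from φ b))) (cong g (to∘from φ b)) }

_⟫_ : ∀ {A B C f g h} → StatIso A B f g → StatIso B C g h → StatIso A C f h
φ ⟫ ψ = record
  { to        = to ψ ∘ to φ
  ; from      = from φ ∘ from ψ
  ; from∘to   = λ a → trans (cong (from φ) (from∘to ψ (to φ a))) (from∘to φ a)
  ; to∘from   = λ c → trans (cong (to ψ) (to∘from φ (from ψ c))) (to∘from ψ c)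
  ; preserves = λ a → trans (preserves ψ (to φ a)) (preserves φ a) }

StatIso⇒↔ : ∀ {A B f g} → StatIso A B f g → A ↔ B
StatIso⇒↔ φ = mk↔ₛ′ (to φ) (from φ) (to∘from φ) (from∘to φ)

StatIso⇒SameGenFun : ∀ {A B f g} → StatIso A B f g → SameGenFun A B f g
StatIso⇒SameGenFun {A} {B} {f} {g} φ k =
  mk↔ₛ′ forth back (λ { (b , _) → fibre-≡ (to∘from φ b) }) (λ { (a , _) → fibre-≡ (from∘to φ a) })
  where
  forth : Σ A (λ a → f a ≡ k) → Σ B (λ b → g b ≡ k)
  forth (a , fa≡k) = to φ a , trans (preserves φ a) fa≡k
  back : Σ B (λ b → g b ≡ k) → Σ A (λ a → f a ≡ k)
  back (b , gb≡k) = from φ b , trans (preserves (φ ⁻¹) b) gb≡k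
  fibre-≡ : ∀ {C : Set} {h : C → ℤ} {x y : C} {p : h x ≡ k} {q : h y ≡ k} →
            x ≡ y → (Σ C (λ z → h z ≡ k) ∋ (x , p)) ≡ (y , q)
  fibre-≡ refl = cong (_ ,_) (Decidable⇒UIP.≡-irrelevant ℤ._≟_ _ _)

Σ-T-≡ : ∀ {A : Set} {P : A → Bool} {x y : A} {p : T (P x)} {q : T (P y)} →
        x ≡ y → (Σ A (T ∘ P) ∋ (x , p)) ≡ (y , q)
Σ-T-≡ {P = P} {x} refl = cong (x ,_) (T-irrelevant _ _)

-- Equidistribution

module Equidistribution {n m' : ℕ} (P : Array n → Bool) (P⇒isC : ∀ c → T (P c) → T (isC n m' c))
         (P-bk : ∀ r c → 1 ≤ r → InC n m' c → T (P c) → T (P (BenderKnuth.bk m' r c))) where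
  private
    X : Set
    X = Σ (Array n) (T ∘ P)
    N : ℕ
    N = n + m'
    valid : (x : X) → InC n m' (proj₁ x)
    valid (c , p) = isC⇒InC c (P⇒isC c p)

  bk-StatIso : ∀ r → 1 ≤ r → StatIso X X (stat N r ∘ proj₁) (stat N (suc r) ∘ proj₁)
  bk-StatIso r 1≤r = record
    { to = bk′ ; from = bk′ ; from∘to = involutive ; to∘from = involutive
    ; preserves = λ x → stat-bk (valid x) 1≤r }
    where
    bk′ : X → X
    bk′ x@(c , p) = BenderKnuth.bk m' r c , P-bk r c 1≤r (valid x) p
    involutive : ∀ x → bk′ (bk′ x) ≡ x
    involutive x = Σ-T-≡ (bk-involutive (valid x) 1≤r)

  stat-StatIso : ∀ r R → 1 ≤ r → r ≤ R → StatIso X X (stat N r ∘ proj₁) (stat N R ∘ proj₁)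
  stat-StatIso r R 1≤r r≤R with m≤n⇒m<n∨m≡n r≤R
  ... | inj₂ refl = StatIso-refl (λ _ → refl)
  stat-StatIso r (suc R) 1≤r _ | inj₁ (s≤s r≤R) =
    stat-StatIso r R 1≤r r≤R ⟫ bk-StatIso R (≤-trans 1≤r r≤R)

  Ubar-StatIso : ∀ r → 1 ≤ r → r ≤ N → StatIso X X (Ubar n m' r ∘ proj₁) (stat N r ∘ proj₁)
  Ubar-StatIso r 1≤r r≤N = StatIso-refl (λ x → sym (Ubar≡stat (valid x) r 1≤r r≤N))

module StatsOnC {n} (m' : ℕ) = Equidistribution {n} {m'} (isC n m') (λ _ p → p)
  (λ r c 1≤r valid _ → InC⇒isC _ (bk-valid valid 1≤r))

module StatsOnCcol {n} (m' : ℕ) = Equidistribution {n} {m'} (λ c → isC n m' c ∧ allColsEven c)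
  (λ c p → proj₁ (T-∧⁻ {isC n m' c} p))
  (λ r c 1≤r valid p → T-∧⁺ (InC⇒isC _ (bk-valid valid 1≤r))
     (subst T (sym (allColsEven-mapCells (BenderKnuth.bkCell m' r c) c)) (proj₂ (T-∧⁻ {isC n m' c} p))))

lift-StatIso : ∀ {n} m {f g} → (∀ c → InC n m c → g (lift c) ≡ f c) →
               StatIso (CSet n m) (CcolSet n (suc m)) (f ∘ proj₁) (g ∘ proj₁)
lift-StatIso {n} m g∘lift≗f = record
  { to        = λ (c , p) → lift c , T-∧⁺ (InC⇒isC _ (lift-valid (isC⇒InC c p))) (lift-allColsEven c)
  ; from      = λ (c , p) → lower c , InC⇒isC _ (lower-valid (colValid c p))
  ; from∘to   = λ (c , p) → Σ-T-≡ (lower-lift (isC⇒InC c p))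
  ; to∘from   = λ (c , p) → Σ-T-≡ (lift-lower (colValid c p) (proj₂ (T-∧⁻ {isC n (suc m) c} p)))
  ; preserves = λ (c , p) → g∘lift≗f c (isC⇒InC c p) }
  where
  colValid : ∀ c → T (isC n (suc m) c ∧ allColsEven c) → InC n (suc m) c
  colValid c p = isC⇒InC c (proj₁ (T-∧⁻ {isC n (suc m) c} p))

corollary7p6 : (m n r s : ℕ) → 1 ≤ n → 1 ≤ r → r ≤ n → 1 ≤ s → s ≤ n →
    SameGenFun (CSet n m) (CcolSet n (suc m))
               (λ c → Ubar n m r (proj₁ c)) (λ c → Ubar n (suc m) s (proj₁ c))
    × SameGenFun (CcolSet n (suc m)) (CSet n m)
                 (λ c → Ubar n (suc m) s (proj₁ c)) (λ c → + VC (proj₁ c))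
    × (CSet n m ↔ CcolSet n (suc m))
corollary7p6 m n r s 1≤n 1≤r r≤n 1≤s s≤n =
    StatIso⇒SameGenFun (ubar-C ⟫ StatsOnC.stat-StatIso m r N 1≤r r≤N ⟫ lift-top ⟫
                        StatsOnCcol.stat-StatIso (suc m) s (suc N) 1≤s s≤N+1 ⁻¹ ⟫ ubar-Ccol ⁻¹)
  , StatIso⇒SameGenFun (ubar-Ccol ⟫ StatsOnCcol.stat-StatIso (suc m) 1 s ≤-refl 1≤s ⁻¹ ⟫ lift-1 ⁻¹)
  , StatIso⇒↔ lift-1
  where
  N N′ : ℕ
  N  = n + m
  N′ = n + suc m
  r≤N : r ≤ N
  r≤N = ≤-trans r≤n (m≤m+n n m)
  s≤N+1 : s ≤ suc N
  s≤N+1 = ≤-trans s≤n (≤-trans (m≤m+n n m) (n≤1+n N))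
  ubar-C : StatIso (CSet n m) (CSet n m) (Ubar n m r ∘ proj₁) (stat N r ∘ proj₁)
  ubar-C = StatsOnC.Ubar-StatIso m r 1≤r r≤N
  ubar-Ccol : StatIso (CcolSet n (suc m)) (CcolSet n (suc m)) (Ubar n (suc m) s ∘ proj₁) (stat N′ s ∘ proj₁)
  ubar-Ccol = StatsOnCcol.Ubar-StatIso (suc m) s 1≤s (≤-trans s≤n (m≤m+n n (suc m)))
  lift-top : StatIso (CSet n m) (CcolSet n (suc m)) (stat N N ∘ proj₁) (stat N′ (suc N) ∘ proj₁)
  lift-top = lift-StatIso m (λ _ valid → stat-lift-top valid 1≤n)
  lift-1 : StatIso (CSet n m) (CcolSet n (suc m)) (λ x → + VC (proj₁ x)) (stat N′ 1 ∘ proj₁)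
  lift-1 = lift-StatIso m (λ _ valid → stat-lift-1 valid)
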